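{- Let $\psi_n$ and $\Psi_n$ be defined as in the context. For every $n \geq 1$, \[ \psi_n = \sum_{j=1}^{n}(n)_{n-j}\bigl(\sigma^\star_j + \Psi_j\bigr), \] and the sum of the coefficients of $\psi_n$ satisfies \[ \psi_n(1,\ldots,1) = n! + \sum_{j=2}^{n}(n)_{n-j}\,\Psi_j(1,\ldots,1). \]
   Context: Partial Bell polynomials: $B_{N,k}(y_1,\ldots,y_{N-k+1}) = \sum \frac{N!}{j_1!\cdots j_{N-k+1}!}\prod_{i}(y_i/i!)^{j_i}$ over nonnegative integers $j_i$ with $\sum_i i j_i = N$, $\sum_i j_i = k$; $B_N = \sum_{k=1}^N B_{N,k}$. $\sigma^\star_n = (-1)^n B_n(-x_1,-1!\,x_2,\ldots,-(n-1)!\,x_n)$. Stirling numbers of the first kind $S_1(N,k)$ are defined by $x(x-1)\cdots(x-N+1) = \sum_k S_1(N,k)x^k$, and $(n)_k = n!/(n-k)!$. Define $\psi_0 = 0$ and for $n \geq 1$ \[ \psi_n = n\,\psi_{n-1} + \sigma^\star_n + \Psi_n,\qquad \Psi_n = \sum_{\nu=2}^{n}\sum_{k=0}^{\min(\nu,n-\nu)} (-1)^{\nu+1} S_1(\nu+1,k+1)\,(n)_k\, B_{n-k,\nu}(\psi_1,\ldots,\psi_{n-k-\nu+1}). \] -}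

module Defs where

open import Level using (Level)
open import Data.Nat as ℕ using (ℕ; zero; suc; _∸_; NonZero; _!; _≤ᵇ_; _≡ᵇ_)
open import Data.Nat.Properties using (m*n≢0; m^n≢0; _!≢0)
open import Data.Nat.Combinatorics using (_P_)
open import Data.Integer as ℤ using (ℤ; +_; -[1+_])
open import Data.List using (List; []; _∷_; map; concatMap; applyUpTo; upTo; foldr; filterᵇ)
open import Data.Bool using (Bool; true; false; if_then_else_; _∧_)
open import Algebra.Bundles using (CommutativeRing)

-- Coefficient lists (constant term first) of polynomials over ℤ.
addL : List ℤ → List ℤ → List ℤ
addL []       q        = q
addL p        []       = p
addL (a ∷ p)  (b ∷ q)  = (a ℤ.+ b) ∷ addL p q

scaleL : ℤ → List ℤ → List ℤ
scaleL c = map (c ℤ.*_)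

mulXminus : ℤ → List ℤ → List ℤ
mulXminus c p = addL (+ 0 ∷ p) (scaleL (ℤ.- c) p)

fallingPoly : ℕ → List ℤ
fallingPoly zero    = + 1 ∷ []
fallingPoly (suc N) = mulXminus (+ N) (fallingPoly N)

coeff : ℕ → List ℤ → ℤ
coeff _       []      = + 0
coeff zero    (a ∷ _) = a
coeff (suc k) (_ ∷ p) = coeff k p

S₁ : ℕ → ℕ → ℤ
S₁ N k = coeff k (fallingPoly N)

ff : ℕ → ℕ → ℕ
ff n k = n P k

tuples : ℕ → ℕ → List (List ℕ)
tuples zero    b = [] ∷ []
tuples (suc m) b = concatMap (λ j → map (j ∷_) (tuples m b)) (upTo (suc b))

wsum : ℕ → List ℕ → ℕ
wsum i []       = 0
wsum i (j ∷ js) = i ℕ.* j ℕ.+ wsum (suc i) js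

lsum : List ℕ → ℕ
lsum = foldr ℕ._+_ 0

bellIndices : ℕ → ℕ → List (List ℕ)
bellIndices N k =
  filterᵇ (λ js → (wsum 1 js ≡ᵇ N) ∧ (lsum js ≡ᵇ k)) (tuples (suc N ∸ k) N)

denom : ℕ → List ℕ → ℕ
denom i []       = 1
denom i (j ∷ js) = (j ! ℕ.* ((i !) ℕ.^ j)) ℕ.* denom (suc i) js

denom≢0 : ∀ i js → NonZero (denom i js)
denom≢0 i []       = _
denom≢0 i (j ∷ js) =
  m*n≢0 _ _ {{m*n≢0 _ _ {{j !≢0}} {{m^n≢0 (i !) j {{i !≢0}}}}}} {{denom≢0 (suc i) js}}

-- N! / (∏ j_i! (i!)^{j_i})  (an exact division)
bellCoeff : ℕ → List ℕ → ℕ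
bellCoeff N js = ℕ._/_ (N !) (denom 1 js) {{denom≢0 1 js}}

module _ {c ℓ : Level} (R : CommutativeRing c ℓ) where
  open CommutativeRing R

  natMul : ℕ → Carrier → Carrier
  natMul zero    a = 0#
  natMul (suc n) a = a + natMul n a

  intR : ℤ → Carrier
  intR (+ n)     = natMul n 1#
  intR -[1+ n ]  = - natMul (suc n) 1#

  pow : Carrier → ℕ → Carrier
  pow a zero    = 1#
  pow a (suc n) = a * pow a n

  -- Σ_{i=a}^{b} f i  (empty if b < a)
  sumFT : ℕ → ℕ → (ℕ → Carrier) → Carrier
  sumFT a b f = foldr _+_ 0# (applyUpTo (λ i → f (a ℕ.+ i)) (suc b ∸ a))

  monom : (ℕ → Carrier) → ℕ → List ℕ → Carrier
  monom y i []       = 1#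
  monom y i (j ∷ js) = pow (y i) j * monom y (suc i) js

  -- partial Bell polynomial B_{N,k}(y_1,…,y_{N-k+1}); y_i = y i (i ≥ 1)
  bellPartial : ℕ → ℕ → (ℕ → Carrier) → Carrier
  bellPartial N k y =
    foldr _+_ 0# (map (λ js → natMul (bellCoeff N js) (monom y 1 js)) (bellIndices N k))

  bellComplete : ℕ → (ℕ → Carrier) → Carrier
  bellComplete N y = sumFT 1 N (λ k → bellPartial N k y)

  σ⋆ : (ℕ → Carrier) → ℕ → Carrier
  σ⋆ x n = pow (- 1#) n * bellComplete n (λ i → - (natMul ((i ∸ 1) !) (x i)))

  -- Ψ_n as a function of the sequence (ψ_1, ψ_2, …) =: y
  Ψwith : (ℕ → Carrier) → ℕ → Carrier
  Ψwith y n =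
    sumFT 2 n (λ ν → sumFT 0 (ℕ._⊓_ ν (n ∸ ν)) (λ k →
      intR (ℤ._*_ (ℤ._*_ ((ℤ.- ℤ.1ℤ) ℤ.^ suc ν) (S₁ (suc ν) (suc k))) (+ ff n k))
        * bellPartial (n ∸ k) ν y))

  -- ψupto n m = ψ_m for m ≤ n, and 0 for m > n
  ψupto : (ℕ → Carrier) → ℕ → ℕ → Carrier
  ψupto x zero    m = 0#
  ψupto x (suc n) m =
    if m ≤ᵇ n then ψupto x n m
    else (if m ≡ᵇ suc n
          then natMul (suc n) (ψupto x n n) + σ⋆ x (suc n) + Ψwith (ψupto x n) (suc n)
          else 0#)

  ψ : (ℕ → Carrier) → ℕ → Carrier
  ψ x n = ψupto x n n

  Ψ : (ℕ → Carrier) → ℕ → Carrier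
  Ψ x n = Ψwith (ψ x) n

module Submission where

-- The first identity unrolls ψ_n = n ψ_{n-1} + (σ⋆_n + Ψ_n), using (n)_{n-j} = n (n-1)_{n-1-j}.
-- For the second, at x = (1, 1, …) the arguments of σ⋆_n are y_q = -(q-1)!, whose exponential generating
-- function is log (1 - t); so B_n(y) = Σ_k B_{n,k}(y) is n! [tⁿ] (1 - t), i.e. σ⋆_1 = 1 and σ⋆_n = 0 for n ≥ 2,
-- and the σ⋆-part of the first identity reduces to (n)_{n-1} = n!. Instead of power series we use the recurrence
-- N B_N = Σ_q q (N choose q) y_q B_{N-q}, obtained by marking one of the N points and splitting off its part.
-- Here it reads N B_N = - Σ_q N!/(N-q)! B_{N-q}, which forces B_N = 0 for N ≥ 2 once N can be cancelled;
-- so it is solved over ℤ and carried to any commutative ring along the homomorphism ℤ → R.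

open import Defs
open import Level using (Level; _⊔_)
open import Data.Nat as ℕ using (ℕ; zero; suc; _∸_; _≤_; _<_; z≤n; s≤s; _!; _≤ᵇ_; _≡ᵇ_; _⊓_; NonZero)
import Data.Nat.Properties as ℕₚ
open import Data.Nat.Combinatorics using (_C_; _P_; nPn≡n!)
open import Data.Nat.Induction using (<-rec)
open import Data.Nat.Tactic.RingSolver using (solve-∀)
import Data.Integer as ℤ
import Data.Integer.Properties as ℤₚ
import Data.Sign as Sign
open import Data.Bool using (Bool; true; false; _∧_; T)
import Data.Bool.Properties as Boolₚ
open import Data.List using (List; []; _∷_; map; concatMap; applyUpTo; foldr; filterᵇ; _++_; length)
open import Data.Product using (_×_; _,_; proj₁; proj₂)
open import Data.Empty using (⊥-elim)
open import Function using (Equivalence)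
open import Relation.Nullary using (¬_)
open import Relation.Binary.PropositionalEquality as ≡ using (_≡_)
open import Algebra.Bundles using (CommutativeRing; CommutativeMonoid)

module RingSums {c ℓ : Level} (R : CommutativeRing c ℓ) where
  open CommutativeRing R
  open import Relation.Binary.Reasoning.Setoid setoid
  open import Algebra.Properties.Ring ring using (-0#≈0#; -‿+-comm)
  open import Algebra.Properties.CommutativeSemigroup +-commutativeSemigroup using (interchange)
  open import Algebra.Properties.Semiring.Mult semiring public renaming (_×_ to _·_)
  open import Algebra.Properties.CommutativeMonoid.Mult +-commutativeMonoid public using (×-distrib-+)

  natMul≡· : ∀ n x → natMul R n x ≡ n · x
  natMul≡· zero    x = ≡.refl
  natMul≡· (suc n) x = ≡.cong (x +_) (natMul≡· n x)

  TorsionFree : Set (c ⊔ ℓ)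
  TorsionFree = ∀ n x → suc n · x ≈ 0# → x ≈ 0#

  ·-zeroʳ : ∀ n → n · 0# ≈ 0#
  ·-zeroʳ zero    = refl
  ·-zeroʳ (suc n) = trans (+-identityˡ _) (·-zeroʳ n)

  ·-neg : ∀ n x → n · (- x) ≈ - (n · x)
  ·-neg zero    x = sym -0#≈0#
  ·-neg (suc n) x = trans (+-congˡ (·-neg n x)) (-‿+-comm x (n · x))

  ·-* : ∀ m n x y → (m · x) * (n · y) ≈ (m ℕ.* n) · (x * y)
  ·-* m n x y = begin
    (m · x) * (n · y) ≈⟨ ×-assoc-* m x (n · y) ⟩
    m · (x * (n · y)) ≈⟨ ×-congʳ m (×-comm-* n x y) ⟩
    m · (n · (x * y)) ≈⟨ ×-assocˡ (x * y) m n ⟩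
    (m ℕ.* n) · (x * y) ∎

  ∑< : ℕ → (ℕ → Carrier) → Carrier
  ∑< zero    f = 0#
  ∑< (suc n) f = f 0 + ∑< n (λ i → f (suc i))

  ∑<-cong : ∀ n {f g} → (∀ i → i < n → f i ≈ g i) → ∑< n f ≈ ∑< n g
  ∑<-cong zero    f≈g = refl
  ∑<-cong (suc n) f≈g = +-cong (f≈g 0 (s≤s z≤n)) (∑<-cong n (λ i i<n → f≈g (suc i) (s≤s i<n)))

  ∑<-cong′ : ∀ n {f g} → (∀ i → f i ≈ g i) → ∑< n f ≈ ∑< n g
  ∑<-cong′ n f≈g = ∑<-cong n (λ i _ → f≈g i)

  ∑<-zero : ∀ n {f} → (∀ i → i < n → f i ≈ 0#) → ∑< n f ≈ 0#
  ∑<-zero zero    f≈0 = refl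
  ∑<-zero (suc n) f≈0 =
    trans (+-cong (f≈0 0 (s≤s z≤n)) (∑<-zero n (λ i i<n → f≈0 (suc i) (s≤s i<n)))) (+-identityʳ 0#)

  ∑<-distrib-+ : ∀ n f g → ∑< n (λ i → f i + g i) ≈ ∑< n f + ∑< n g
  ∑<-distrib-+ zero    f g = sym (+-identityʳ 0#)
  ∑<-distrib-+ (suc n) f g = trans (+-congˡ (∑<-distrib-+ n _ _)) (interchange _ _ _ _)

  ∑<-neg : ∀ n f → ∑< n (λ i → - f i) ≈ - ∑< n f
  ∑<-neg zero    f = sym -0#≈0#
  ∑<-neg (suc n) f = trans (+-congˡ (∑<-neg n (λ i → f (suc i)))) (-‿+-comm _ _)

  *-distribˡ-∑< : ∀ n x f → x * ∑< n f ≈ ∑< n (λ i → x * f i)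
  *-distribˡ-∑< zero    x f = zeroʳ x
  *-distribˡ-∑< (suc n) x f = trans (distribˡ x _ _) (+-congˡ (*-distribˡ-∑< n x _))

  ·-distrib-∑< : ∀ n k f → k · ∑< n f ≈ ∑< n (λ i → k · f i)
  ·-distrib-∑< zero    k f = ·-zeroʳ k
  ·-distrib-∑< (suc n) k f = trans (×-distrib-+ _ _ k) (+-congˡ (·-distrib-∑< n k _))

  ∑<-last : ∀ n f → ∑< (suc n) f ≈ ∑< n f + f n
  ∑<-last zero    f = trans (+-identityʳ _) (sym (+-identityˡ _))
  ∑<-last (suc n) f = trans (+-congˡ (∑<-last n (λ i → f (suc i)))) (sym (+-assoc _ _ _))

  ∑<-split : ∀ m n f → ∑< (m ℕ.+ n) f ≈ ∑< m f + ∑< n (λ i → f (m ℕ.+ i))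
  ∑<-split zero    n f = sym (+-identityˡ _)
  ∑<-split (suc m) n f = trans (+-congˡ (∑<-split m n (λ i → f (suc i)))) (sym (+-assoc _ _ _))

  ∑<-comm : ∀ m n (f : ℕ → ℕ → Carrier) →
            ∑< m (λ i → ∑< n (λ j → f i j)) ≈ ∑< n (λ j → ∑< m (λ i → f i j))
  ∑<-comm zero    n f = sym (∑<-zero n (λ _ _ → refl))
  ∑<-comm (suc m) n f = trans (+-congˡ (∑<-comm m n (λ i → f (suc i)))) (sym (∑<-distrib-+ n _ _))

  sumFT≡∑< : ∀ a b f → sumFT R a b f ≡ ∑< (suc b ∸ a) (λ i → f (a ℕ.+ i))
  sumFT≡∑< a b f = foldr-applyUpTo (suc b ∸ a) _
    where
    foldr-applyUpTo : ∀ n g → foldr _+_ 0# (applyUpTo g n) ≡ ∑< n g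
    foldr-applyUpTo zero    g = ≡.refl
    foldr-applyUpTo (suc n) g = ≡.cong (g 0 +_) (foldr-applyUpTo n (λ i → g (suc i)))

  ∑ᴸ : {A : Set} → List A → (A → Carrier) → Carrier
  ∑ᴸ []       f = 0#
  ∑ᴸ (a ∷ as) f = f a + ∑ᴸ as f

  ∑ᴸ-cong : {A : Set} (as : List A) {f g : A → Carrier} → (∀ a → f a ≈ g a) → ∑ᴸ as f ≈ ∑ᴸ as g
  ∑ᴸ-cong []       f≈g = refl
  ∑ᴸ-cong (a ∷ as) f≈g = +-cong (f≈g a) (∑ᴸ-cong as f≈g)

  ∑ᴸ-++ : {A : Set} (as bs : List A) (f : A → Carrier) → ∑ᴸ (as ++ bs) f ≈ ∑ᴸ as f + ∑ᴸ bs f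
  ∑ᴸ-++ []       bs f = sym (+-identityˡ _)
  ∑ᴸ-++ (a ∷ as) bs f = trans (+-congˡ (∑ᴸ-++ as bs f)) (sym (+-assoc _ _ _))

  ∑ᴸ-map : {A B : Set} (as : List A) (g : A → B) (f : B → Carrier) → ∑ᴸ (map g as) f ≡ ∑ᴸ as (λ a → f (g a))
  ∑ᴸ-map []       g f = ≡.refl
  ∑ᴸ-map (a ∷ as) g f = ≡.cong (f (g a) +_) (∑ᴸ-map as g f)

  ∑ᴸ-concatMap : {A B : Set} (n : ℕ) (g : ℕ → A) (h : A → List B) (f : B → Carrier) →
                 ∑ᴸ (concatMap h (applyUpTo g n)) f ≈ ∑< n (λ j → ∑ᴸ (h (g j)) f)
  ∑ᴸ-concatMap zero    g h f = refl
  ∑ᴸ-concatMap (suc n) g h f = trans (∑ᴸ-++ (h (g 0)) _ f) (+-congˡ (∑ᴸ-concatMap n (λ i → g (suc i)) h f))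

  *-distribˡ-∑ᴸ : {A : Set} (as : List A) (x : Carrier) (f : A → Carrier) → x * ∑ᴸ as f ≈ ∑ᴸ as (λ a → x * f a)
  *-distribˡ-∑ᴸ []       x f = zeroʳ x
  *-distribˡ-∑ᴸ (a ∷ as) x f = trans (distribˡ x _ _) (+-congˡ (*-distribˡ-∑ᴸ as x f))

  foldr-map≡∑ᴸ : {A : Set} (as : List A) (f : A → Carrier) → foldr _+_ 0# (map f as) ≡ ∑ᴸ as f
  foldr-map≡∑ᴸ []       f = ≡.refl
  foldr-map≡∑ᴸ (a ∷ as) f = ≡.cong (f a +_) (foldr-map≡∑ᴸ as f)

  when : Bool → Carrier → Carrier
  when true  x = x
  when false x = 0#

  when-cong : ∀ b {x y} → (T b → x ≈ y) → when b x ≈ when b y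
  when-cong true  x≈y = x≈y _
  when-cong false x≈y = refl

  when-true : ∀ b {x} → T b → when b x ≈ x
  when-true true _ = refl

  when-false : ∀ b {x} → ¬ T b → when b x ≈ 0#
  when-false true  ¬b = ⊥-elim (¬b _)
  when-false false ¬b = refl

  when-0# : ∀ b → when b 0# ≈ 0#
  when-0# true  = refl
  when-0# false = refl

  when-zero : ∀ b {x} → (T b → x ≈ 0#) → when b x ≈ 0#
  when-zero b x≈0 = trans (when-cong b x≈0) (when-0# b)

  *-when : ∀ b x y → x * when b y ≈ when b (x * y)
  *-when true  x y = refl
  *-when false x y = zeroʳ x

  ·-when : ∀ b n x → n · when b x ≈ when b (n · x)
  ·-when true  n x = refl
  ·-when false n x = ·-zeroʳ n

  when-+ : ∀ b x y → when b (x + y) ≈ when b x + when b y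
  when-+ true  x y = refl
  when-+ false x y = sym (+-identityʳ 0#)

  when-∑< : ∀ b n f → when b (∑< n f) ≈ ∑< n (λ i → when b (f i))
  when-∑< true  n f = refl
  when-∑< false n f = sym (∑<-zero n (λ _ _ → refl))

  when-∑ᴸ : {A : Set} (as : List A) (b : Bool) (f : A → Carrier) → when b (∑ᴸ as f) ≈ ∑ᴸ as (λ a → when b (f a))
  when-∑ᴸ as       true  f = refl
  when-∑ᴸ []       false f = refl
  when-∑ᴸ (a ∷ as) false f = trans (when-∑ᴸ as false f) (sym (+-identityˡ _))

  when-*-when : ∀ a b x y → when a (x * when b y) ≈ when (a ∧ b) (x * y)
  when-*-when true  b x y = *-when b x y
  when-*-when false b x y = refl

  when-∧ : ∀ a b x → when (a ∧ b) x ≡ when a (when b x)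
  when-∧ true  b x = ≡.refl
  when-∧ false b x = ≡.refl

  when-⇔ : ∀ a b {x y} → (T a → T b) → (T b → T a) → (T a → x ≈ y) → when a x ≈ when b y
  when-⇔ true  true  _   _   x≈y = x≈y _
  when-⇔ true  false a⇒b _   _   = ⊥-elim (a⇒b _)
  when-⇔ false true  _   b⇒a _   = ⊥-elim (b⇒a _)
  when-⇔ false false _   _   _   = refl

  ∑ᴸ-filterᵇ : {A : Set} (as : List A) (p : A → Bool) (f : A → Carrier) →
               ∑ᴸ (filterᵇ p as) f ≈ ∑ᴸ as (λ a → when (p a) (f a))
  ∑ᴸ-filterᵇ []       p f = refl
  ∑ᴸ-filterᵇ (a ∷ as) p f with p a
  ... | true  = +-congˡ (∑ᴸ-filterᵇ as p f)
  ... | false = trans (∑ᴸ-filterᵇ as p f) (sym (+-identityˡ _))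

  ∑<-truncate : ∀ m n f → m ≤ n → ∑< n (λ p → when (suc p ≤ᵇ m) (f p)) ≈ ∑< m f
  ∑<-truncate m n f m≤n = begin
    ∑< n g                                         ≡⟨ ≡.cong (λ l → ∑< l g) (ℕₚ.m+[n∸m]≡n m≤n) ⟨
    ∑< (m ℕ.+ (n ∸ m)) g                           ≈⟨ ∑<-split m (n ∸ m) g ⟩
    ∑< m g + ∑< (n ∸ m) (λ p → g (m ℕ.+ p))        ≈⟨ +-cong (∑<-cong m (λ p p<m → when-true (suc p ≤ᵇ m) (ℕₚ.≤⇒≤ᵇ p<m)))
                                                             (∑<-zero (n ∸ m) (λ p _ → when-false (suc (m ℕ.+ p) ≤ᵇ m)
                                                               (λ t → ℕₚ.m+n≮m m p (ℕₚ.≤ᵇ⇒≤ _ m t)))) ⟩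
    ∑< m f + 0#                                    ≈⟨ +-identityʳ _ ⟩
    ∑< m f                                         ∎
    where
    g : ℕ → Carrier
    g p = when (suc p ≤ᵇ m) (f p)

module Binomials where
  open import Data.Nat using (_+_; _*_; _^_)
  open import Data.Nat.Properties using (_!≢0; _!*_!≢0)
  open import Data.Nat.Combinatorics using (nCk≡n!/k![n-k]!; k![n∸k]!∣n!; nPk≡n!/[n∸k]!)
  open import Data.Nat.Divisibility using (m≤n⇒m!∣n!)
  open import Data.Nat.DivMod using (m/n*n≡m; m*n/n≡m; _/_)
  open import Relation.Binary.PropositionalEquality using (refl; cong; cong₂; sym; trans; subst)
  open ≡.≡-Reasoning

  private
    nonZero-* : ∀ {a b} → NonZero a → NonZero b → NonZero (a * b)
    nonZero-* {a} {b} a≢0 b≢0 = ℕₚ.m*n≢0 a b {{a≢0}} {{b≢0}}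

  nCk*k![n∸k]!≡n! : ∀ n k → k ≤ n → (n C k) * (k ! * (n ∸ k) !) ≡ n !
  nCk*k![n∸k]!≡n! n k k≤n =
    trans (cong (_* (k ! * (n ∸ k) !)) (nCk≡n!/k![n-k]! k≤n)) (m/n*n≡m {{k !* (n ∸ k) !≢0}} (k![n∸k]!∣n! k≤n))

  nPk*[n∸k]!≡n! : ∀ n k → k ≤ n → (n P k) * (n ∸ k) ! ≡ n !
  nPk*[n∸k]!≡n! n k k≤n =
    trans (cong (_* (n ∸ k) !) (nPk≡n!/[n∸k]! k≤n)) (m/n*n≡m {{(n ∸ k) !≢0}} (m≤n⇒m!∣n! (ℕₚ.m∸n≤m n k)))

  nCk*k!≡nPk : ∀ n k → k ≤ n → (n C k) * k ! ≡ n P k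
  nCk*k!≡nPk n k k≤n = ℕₚ.*-cancelʳ-≡ _ _ ((n ∸ k) !) {{(n ∸ k) !≢0}} (begin
    (n C k) * k ! * (n ∸ k) ! ≡⟨ ℕₚ.*-assoc (n C k) (k !) ((n ∸ k) !) ⟩
    (n C k) * (k ! * (n ∸ k) !) ≡⟨ nCk*k![n∸k]!≡n! n k k≤n ⟩
    n !                         ≡⟨ nPk*[n∸k]!≡n! n k k≤n ⟨
    (n P k) * (n ∸ k) !         ∎)

  [1+k]*nC[1+k]*k!≡nP[1+k] : ∀ n k → suc k ≤ n → suc k * (n C suc k) * k ! ≡ n P suc k
  [1+k]*nC[1+k]*k!≡nP[1+k] n k k<n = trans (regroup k (n C suc k) (k !)) (nCk*k!≡nPk n (suc k) k<n)
    where
    regroup : ∀ k c x → suc k * c * x ≡ c * (suc k * x)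
    regroup = solve-∀

  [1+n]Pn≡[1+n]! : ∀ n → suc n P n ≡ suc n !
  [1+n]Pn≡[1+n]! n = trans (sym (ℕₚ.*-identityʳ (suc n P n)))
                            (trans (cong (λ t → (suc n P n) * t !) (sym (ℕₚ.m+n∸n≡m 1 n))) (nPk*[n∸k]!≡n! (suc n) n (ℕₚ.n≤1+n n)))

  n∸k∸l≡n∸l∸k : ∀ n k l → n ∸ k ∸ l ≡ n ∸ l ∸ k
  n∸k∸l≡n∸l∸k n k l = trans (ℕₚ.∸-+-assoc n k l) (trans (cong (n ∸_) (ℕₚ.+-comm k l)) (sym (ℕₚ.∸-+-assoc n l k)))

  nCa*[n∸a]Cq≡nCq*[n∸q]Ca : ∀ n a q → a + q ≤ n → (n C a) * ((n ∸ a) C q) ≡ (n C q) * ((n ∸ q) C a)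
  nCa*[n∸a]Cq≡nCq*[n∸q]Ca n a q a+q≤n =
    ℕₚ.*-cancelʳ-≡ _ _ d {{nonZero-* (a !≢0) (nonZero-* (q !≢0) ((n ∸ a ∸ q) !≢0))}} (trans (ordered a q a+q≤n) (sym (begin
      (n C q) * ((n ∸ q) C a) * d                   ≡⟨ cong (λ t → (n C q) * ((n ∸ q) C a) * (a ! * (q ! * t !))) (n∸k∸l≡n∸l∸k n a q) ⟩
      (n C q) * ((n ∸ q) C a) * (a ! * (q ! * (n ∸ q ∸ a) !)) ≡⟨ cong ((n C q) * ((n ∸ q) C a) *_) (swap (a !) (q !) _) ⟩
      (n C q) * ((n ∸ q) C a) * (q ! * (a ! * (n ∸ q ∸ a) !)) ≡⟨ ordered q a (subst (_≤ n) (ℕₚ.+-comm a q) a+q≤n) ⟩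
      n !                                           ∎)))
    where
    d = a ! * (q ! * (n ∸ a ∸ q) !)
    swap : ∀ x y z → x * (y * z) ≡ y * (x * z)
    swap = solve-∀
    regroup : ∀ c c′ x y z → c * c′ * (x * (y * z)) ≡ c * (x * (c′ * (y * z)))
    regroup = solve-∀
    ordered : ∀ a q → a + q ≤ n → (n C a) * ((n ∸ a) C q) * (a ! * (q ! * (n ∸ a ∸ q) !)) ≡ n !
    ordered a q a+q≤n = begin
      (n C a) * ((n ∸ a) C q) * (a ! * (q ! * (n ∸ a ∸ q) !)) ≡⟨ regroup (n C a) ((n ∸ a) C q) (a !) (q !) _ ⟩
      (n C a) * (a ! * (((n ∸ a) C q) * (q ! * (n ∸ a ∸ q) !)))
        ≡⟨ cong (λ t → (n C a) * (a ! * t)) (nCk*k![n∸k]!≡n! (n ∸ a) q (ℕₚ.m+n≤o⇒m≤o∸n q (subst (_≤ n) (ℕₚ.+-comm a q) a+q≤n))) ⟩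
      (n C a) * (a ! * (n ∸ a) !)                              ≡⟨ nCk*k![n∸k]!≡n! n a (ℕₚ.m+n≤o⇒m≤o a a+q≤n) ⟩
      n !                                                      ∎

  nCa*c*[q*[n∸a]Cq]≡[q*nCq]*[[n∸q]Ca*c] : ∀ n a q c → a + q ≤ n →
    ((n C a) * c) * (q * ((n ∸ a) C q)) ≡ (q * (n C q)) * (((n ∸ q) C a) * c)
  nCa*c*[q*[n∸a]Cq]≡[q*nCq]*[[n∸q]Ca*c] n a q c a+q≤n = begin
    ((n C a) * c) * (q * ((n ∸ a) C q)) ≡⟨ regroup (n C a) c q ((n ∸ a) C q) ⟩
    q * c * ((n C a) * ((n ∸ a) C q))   ≡⟨ cong (q * c *_) (nCa*[n∸a]Cq≡nCq*[n∸q]Ca n a q a+q≤n) ⟩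
    q * c * ((n C q) * ((n ∸ q) C a))   ≡⟨ regroup′ (n C q) c q ((n ∸ q) C a) ⟩
    (q * (n C q)) * (((n ∸ q) C a) * c) ∎
    where
    regroup : ∀ x c q x′ → (x * c) * (q * x′) ≡ q * c * (x * x′)
    regroup = solve-∀
    regroup′ : ∀ x c q x′ → q * c * (x * x′) ≡ (q * x) * (x′ * c)
    regroup′ = solve-∀

  -- blocks i j = (i·j)! / (j! (i!)^j): the number of ways to split an (i·j)-set into j blocks of size i.
  -- The block containing a fixed element is fixed by choosing its other i elements.
  blocks : ℕ → ℕ → ℕ
  blocks zero    j       = 1
  blocks (suc i) zero    = 1
  blocks (suc i) (suc j) = ((i + suc i * j) C i) * blocks (suc i) j

  blocks*j!*[i!]^j≡[i*j]! : ∀ i j → blocks (suc i) j * (j ! * (suc i !) ^ j) ≡ (suc i * j) !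
  blocks*j!*[i!]^j≡[i*j]! i zero    = cong _! (sym (ℕₚ.*-zeroʳ i))
  blocks*j!*[i!]^j≡[i*j]! i (suc j) = begin
    c * b * (suc j ! * ((suc i !) ^ suc j))        ≡⟨ regroup c b (j !) (i !) ((suc i !) ^ j) i j ⟩
    c * (i ! * (b * (j ! * (suc i !) ^ j))) * (suc j * suc i)
      ≡⟨ cong (λ t → c * (i ! * t) * (suc j * suc i)) (blocks*j!*[i!]^j≡[i*j]! i j) ⟩
    c * (i ! * (suc i * j) !) * (suc j * suc i)
      ≡⟨ cong (λ t → c * (i ! * t !) * (suc j * suc i)) (sym (ℕₚ.m+n∸m≡n i (suc i * j))) ⟩
    c * (i ! * (i + suc i * j ∸ i) !) * (suc j * suc i)
      ≡⟨ cong (_* (suc j * suc i)) (nCk*k![n∸k]!≡n! (i + suc i * j) i (ℕₚ.m≤m+n i _)) ⟩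
    (i + suc i * j) ! * (suc j * suc i)          ≡⟨ last-factor i j _ ⟩
    suc (i + suc i * j) !                        ≡⟨ cong _! (size i j) ⟨
    (suc i * suc j) !                            ∎
    where
    c = (i + suc i * j) C i
    b = blocks (suc i) j
    regroup : ∀ c b f g h i j → c * b * ((suc j * f) * ((suc i * g) * h)) ≡ c * (g * (b * (f * h))) * (suc j * suc i)
    regroup = solve-∀
    last-factor : ∀ i j x → x * (suc j * suc i) ≡ suc (i + suc i * j) * x
    last-factor = solve-∀
    size : ∀ i j → suc i * suc j ≡ suc (i + suc i * j)
    size = solve-∀

  -- Among i(j+1) points grouped in j+1 blocks of size i, mark one point: first choose its block.
  marked-block : ∀ i j n → suc i + suc i * j ≤ n →
    (suc i * suc j) * ((n C (suc i * suc j)) * blocks (suc i) (suc j))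
    ≡ (suc i * (n C suc i)) * (((n ∸ suc i) C (suc i * j)) * blocks (suc i) j)
  marked-block i j n le =
    ℕₚ.*-cancelʳ-≡ _ _ d {{nonZero-* (nonZero-* (suc j !≢0) (ℕₚ.m^n≢0 (I !) (suc j) {{I !≢0}})) ((n ∸ I * suc j) !≢0)}}
      (trans lhs (sym rhs))
    where
    I = suc i
    d = (suc j ! * (I !) ^ suc j) * (n ∸ I * suc j) !
    I*[1+j]≡I+I*j : I * suc j ≡ I + I * j
    I*[1+j]≡I+I*j = ℕₚ.*-suc I j
    regroupˡ : ∀ a c m d e → a * (c * m) * (d * e) ≡ a * (c * ((m * d) * e))
    regroupˡ = solve-∀
    regroupʳ : ∀ i c c′ m s f g h e → i * c * (c′ * m) * ((s * f) * (g * h) * e)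
               ≡ (i * s) * (c * (g * (c′ * ((m * (f * h)) * e))))
    regroupʳ = solve-∀
    lhs : (I * suc j) * ((n C (I * suc j)) * blocks I (suc j)) * d ≡ (I * suc j) * n !
    lhs = begin
      (I * suc j) * ((n C (I * suc j)) * blocks I (suc j)) * d
        ≡⟨ regroupˡ (I * suc j) (n C (I * suc j)) (blocks I (suc j)) _ _ ⟩
      (I * suc j) * ((n C (I * suc j)) * ((blocks I (suc j) * (suc j ! * (I !) ^ suc j)) * (n ∸ I * suc j) !))
        ≡⟨ cong (λ t → (I * suc j) * ((n C (I * suc j)) * (t * (n ∸ I * suc j) !))) (blocks*j!*[i!]^j≡[i*j]! i (suc j)) ⟩
      (I * suc j) * ((n C (I * suc j)) * ((I * suc j) ! * (n ∸ I * suc j) !))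
        ≡⟨ cong ((I * suc j) *_) (nCk*k![n∸k]!≡n! n (I * suc j) (subst (_≤ n) (sym I*[1+j]≡I+I*j) le)) ⟩
      (I * suc j) * n ! ∎
    rhs : (I * (n C I)) * (((n ∸ I) C (I * j)) * blocks I j) * d ≡ (I * suc j) * n !
    rhs = begin
      (I * (n C I)) * (((n ∸ I) C (I * j)) * blocks I j) * d
        ≡⟨ regroupʳ I (n C I) ((n ∸ I) C (I * j)) (blocks I j) (suc j) (j !) (I !) ((I !) ^ j) _ ⟩
      (I * suc j) * ((n C I) * (I ! * (((n ∸ I) C (I * j)) * ((blocks I j * (j ! * (I !) ^ j)) * (n ∸ I * suc j) !))))
        ≡⟨ cong₂ (λ t u → (I * suc j) * ((n C I) * (I ! * (((n ∸ I) C (I * j)) * (t * u !)))))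
                 (blocks*j!*[i!]^j≡[i*j]! i j) (trans (cong (n ∸_) I*[1+j]≡I+I*j) (sym (ℕₚ.∸-+-assoc n I (I * j)))) ⟩
      (I * suc j) * ((n C I) * (I ! * (((n ∸ I) C (I * j)) * ((I * j) ! * (n ∸ I ∸ I * j) !))))
        ≡⟨ cong (λ t → (I * suc j) * ((n C I) * (I ! * t)))
                (nCk*k![n∸k]!≡n! (n ∸ I) (I * j) (ℕₚ.m+n≤o⇒m≤o∸n (I * j) (subst (_≤ n) (ℕₚ.+-comm I (I * j)) le))) ⟩
      (I * suc j) * ((n C I) * (I ! * (n ∸ I) !))
        ≡⟨ cong ((I * suc j) *_) (nCk*k![n∸k]!≡n! n I (ℕₚ.m+n≤o⇒m≤o I le)) ⟩
      (I * suc j) * n ! ∎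

  -- bellCoeffFrom i (j_i ∷ j_{i+1} ∷ ⋯) counts the partitions of a set of size Σ_l l·j_l into j_l blocks of
  -- size l (l ≥ i), choosing first the elements covered by the blocks of size i.
  bellCoeffFrom : ℕ → List ℕ → ℕ
  bellCoeffFrom i []       = 1
  bellCoeffFrom i (j ∷ js) = (((i * j + wsum (suc i) js) C (i * j)) * blocks i j) * bellCoeffFrom (suc i) js

  bellCoeffFrom*denom≡wsum! : ∀ i js → bellCoeffFrom (suc i) js * denom (suc i) js ≡ (wsum (suc i) js) !
  bellCoeffFrom*denom≡wsum! i []       = refl
  bellCoeffFrom*denom≡wsum! i (j ∷ js) = begin
    c * b * q * ((j ! * (suc i !) ^ j) * d)     ≡⟨ regroup c b q (j ! * (suc i !) ^ j) d ⟩
    c * ((b * (j ! * (suc i !) ^ j)) * (q * d)) ≡⟨ cong₂ (λ u v → c * (u * v)) (blocks*j!*[i!]^j≡[i*j]! i j) (bellCoeffFrom*denom≡wsum! (suc i) js) ⟩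
    c * ((suc i * j) ! * w !)                   ≡⟨ cong (λ t → c * ((suc i * j) ! * t !)) (sym (ℕₚ.m+n∸m≡n (suc i * j) w)) ⟩
    c * ((suc i * j) ! * (suc i * j + w ∸ suc i * j) !) ≡⟨ nCk*k![n∸k]!≡n! (suc i * j + w) (suc i * j) (ℕₚ.m≤m+n _ _) ⟩
    (suc i * j + w) !                           ∎
    where
    w = wsum (suc (suc i)) js
    c = (suc i * j + w) C (suc i * j)
    b = blocks (suc i) j
    q = bellCoeffFrom (suc (suc i)) js
    d = denom (suc (suc i)) js
    regroup : ∀ c b q e d → c * b * q * (e * d) ≡ c * ((b * e) * (q * d))
    regroup = solve-∀

  bellCoeff≡bellCoeffFrom : ∀ n js → wsum 1 js ≡ n → bellCoeff n js ≡ bellCoeffFrom 1 js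
  bellCoeff≡bellCoeffFrom n js refl =
    trans (cong (λ t → (t / denom 1 js) {{denom≢0 1 js}}) (sym (bellCoeffFrom*denom≡wsum! 0 js)))
          (m*n/n≡m (bellCoeffFrom 1 js) (denom 1 js) {{denom≢0 1 js}})

  ff[n,n∸j]*j!≡n! : ∀ n j → j ≤ n → ff n (n ∸ j) * j ! ≡ n !
  ff[n,n∸j]*j!≡n! n j j≤n =
    subst (λ t → ff n (n ∸ j) * t ! ≡ n !) (ℕₚ.m∸[m∸n]≡n j≤n) (nPk*[n∸k]!≡n! n (n ∸ j) (ℕₚ.m∸n≤m n j))

  ff-suc : ∀ n j → j < n → ff (suc n) (n ∸ j) ≡ suc n * ff n (n ∸ suc j)
  ff-suc n j j<n = ℕₚ.*-cancelʳ-≡ _ _ (suc j !) {{suc j !≢0}} (begin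
    ff (suc n) (suc n ∸ suc j) * suc j !   ≡⟨ ff[n,n∸j]*j!≡n! (suc n) (suc j) (ℕₚ.m≤n⇒m≤1+n j<n) ⟩
    suc n * n !                            ≡⟨ cong (suc n *_) (ff[n,n∸j]*j!≡n! n (suc j) j<n) ⟨
    suc n * (ff n (n ∸ suc j) * suc j !)   ≡⟨ ℕₚ.*-assoc (suc n) (ff n (n ∸ suc j)) (suc j !) ⟨
    suc n * ff n (n ∸ suc j) * suc j !     ∎)

open Binomials

module BellCongruence {c ℓ : Level} (R : CommutativeRing c ℓ) where
  open CommutativeRing R
  open RingSums R
  open import Relation.Binary.Reasoning.Setoid setoid

  bellSummand : ℕ → ℕ → (ℕ → Carrier) → List ℕ → Carrier
  bellSummand n k y js = when ((wsum 1 js ≡ᵇ n) ∧ (lsum js ≡ᵇ k)) (bellCoeff n js · monom R y 1 js)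

  bellPartial≈∑ᴸ : ∀ n k y → bellPartial R n k y ≈ ∑ᴸ (tuples (suc n ∸ k) n) (bellSummand n k y)
  bellPartial≈∑ᴸ n k y = begin
    bellPartial R n k y
      ≡⟨ foldr-map≡∑ᴸ (bellIndices n k) _ ⟩
    ∑ᴸ (bellIndices n k) (λ js → natMul R (bellCoeff n js) (monom R y 1 js))
      ≈⟨ ∑ᴸ-cong (bellIndices n k) (λ js → reflexive (natMul≡· (bellCoeff n js) _)) ⟩
    ∑ᴸ (bellIndices n k) (λ js → bellCoeff n js · monom R y 1 js)
      ≈⟨ ∑ᴸ-filterᵇ (tuples (suc n ∸ k) n) _ _ ⟩
    ∑ᴸ (tuples (suc n ∸ k) n) (bellSummand n k y) ∎

  pow-cong : ∀ {a b} j → a ≈ b → pow R a j ≈ pow R b j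
  pow-cong zero    a≈b = refl
  pow-cong (suc j) a≈b = *-cong a≈b (pow-cong j a≈b)

  monom-cong : ∀ {y y′} i js → (∀ t → t < length js → y (i ℕ.+ t) ≈ y′ (i ℕ.+ t)) → monom R y i js ≈ monom R y′ i js
  monom-cong i []       y≈y′ = refl
  monom-cong {y} {y′} i (j ∷ js) y≈y′ =
    *-cong (pow-cong j (≡.subst (λ u → y u ≈ y′ u) (ℕₚ.+-identityʳ i) (y≈y′ 0 (s≤s z≤n))))
           (monom-cong (suc i) js (λ t t< → ≡.subst (λ u → y u ≈ y′ u) (ℕₚ.+-suc i t) (y≈y′ (suc t) (s≤s t<))))

  ∑ᴸ-tuples-cong : ∀ m b {f g : List ℕ → Carrier} → (∀ js → length js ≡ m → f js ≈ g js) →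
                   ∑ᴸ (tuples m b) f ≈ ∑ᴸ (tuples m b) g
  ∑ᴸ-tuples-cong zero    b f≈g = +-congʳ (f≈g [] ≡.refl)
  ∑ᴸ-tuples-cong (suc m) b {f} {g} f≈g = begin
    ∑ᴸ (tuples (suc m) b) f                         ≈⟨ ∑ᴸ-concatMap (suc b) (λ j → j) (λ j → map (j ∷_) (tuples m b)) f ⟩
    ∑< (suc b) (λ j → ∑ᴸ (map (j ∷_) (tuples m b)) f) ≈⟨ ∑<-cong′ (suc b) first ⟩
    ∑< (suc b) (λ j → ∑ᴸ (map (j ∷_) (tuples m b)) g) ≈⟨ ∑ᴸ-concatMap (suc b) (λ j → j) (λ j → map (j ∷_) (tuples m b)) g ⟨
    ∑ᴸ (tuples (suc m) b) g                         ∎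
    where
    first : ∀ j → ∑ᴸ (map (j ∷_) (tuples m b)) f ≈ ∑ᴸ (map (j ∷_) (tuples m b)) g
    first j = begin
      ∑ᴸ (map (j ∷_) (tuples m b)) f          ≡⟨ ∑ᴸ-map (tuples m b) (j ∷_) f ⟩
      ∑ᴸ (tuples m b) (λ js → f (j ∷ js))     ≈⟨ ∑ᴸ-tuples-cong m b (λ js len → f≈g (j ∷ js) (≡.cong suc len)) ⟩
      ∑ᴸ (tuples m b) (λ js → g (j ∷ js))     ≡⟨ ∑ᴸ-map (tuples m b) (j ∷_) g ⟨
      ∑ᴸ (map (j ∷_) (tuples m b)) g          ∎

  bellPartial-cong : ∀ n k {y y′} → (∀ i → i ≤ suc n ∸ k → y i ≈ y′ i) → bellPartial R n k y ≈ bellPartial R n k y′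
  bellPartial-cong n k {y} {y′} y≈y′ = begin
    bellPartial R n k y                           ≈⟨ bellPartial≈∑ᴸ n k y ⟩
    ∑ᴸ (tuples (suc n ∸ k) n) (bellSummand n k y)  ≈⟨ ∑ᴸ-tuples-cong (suc n ∸ k) n (λ js len →
                                                        when-cong ((wsum 1 js ≡ᵇ n) ∧ (lsum js ≡ᵇ k)) (λ _ → ×-congʳ (bellCoeff n js)
                                                          (monom-cong 1 js (λ t t< → y≈y′ (suc t) (≡.subst (suc t ≤_) len t<))))) ⟩
    ∑ᴸ (tuples (suc n ∸ k) n) (bellSummand n k y′) ≈⟨ bellPartial≈∑ᴸ n k y′ ⟨
    bellPartial R n k y′                          ∎

  sumFT-cong : ∀ a b {f g : ℕ → Carrier} → (∀ i → a ≤ i → i ≤ b → f i ≈ g i) → sumFT R a b f ≈ sumFT R a b g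
  sumFT-cong a b {f} {g} f≈g = begin
    sumFT R a b f                      ≡⟨ sumFT≡∑< a b f ⟩
    ∑< (suc b ∸ a) (λ i → f (a ℕ.+ i)) ≈⟨ ∑<-cong (suc b ∸ a) (λ i i< → f≈g (a ℕ.+ i) (ℕₚ.m≤m+n a i) (in-range i i<)) ⟩
    ∑< (suc b ∸ a) (λ i → g (a ℕ.+ i)) ≡⟨ sumFT≡∑< a b g ⟨
    sumFT R a b g                      ∎
    where
    shift : ∀ a i n → i < n ∸ a → a ℕ.+ i < n
    shift zero    i n       i<  = i<
    shift (suc a) i (suc n) i<  = s≤s (shift a i n i<)
    in-range : ∀ i → i < suc b ∸ a → a ℕ.+ i ≤ b
    in-range i i< = ℕₚ.≤-pred (shift a i (suc b) i<)

  bellComplete-cong : ∀ n {y y′} → (∀ i → y i ≈ y′ i) → bellComplete R n y ≈ bellComplete R n y′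
  bellComplete-cong n y≈y′ = sumFT-cong 1 n (λ k _ _ → bellPartial-cong n k (λ i _ → y≈y′ i))

module PsiUnrolling {c ℓ : Level} (R : CommutativeRing c ℓ) where
  open CommutativeRing R
  open RingSums R
  open BellCongruence R
  open import Relation.Binary.Reasoning.Setoid setoid

  ψupto-stable : ∀ x n m → m ≤ n → ψupto R x n m ≡ ψ R x m
  ψupto-stable x n m m≤n = ≡.subst (λ t → ψupto R x t m ≡ ψ R x m) (ℕₚ.m∸n+n≡m m≤n) (above (n ∸ m))
    where
    above : ∀ d → ψupto R x (d ℕ.+ m) m ≡ ψ R x m
    above zero    = ≡.refl
    above (suc d) with m ≤ᵇ d ℕ.+ m | ℕₚ.≤⇒≤ᵇ (ℕₚ.m≤n+m m d)
    ... | true | _ = above d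

  Ψwith-cong : ∀ n {y y′} → (∀ i → i ≤ n → y i ≈ y′ i) → Ψwith R y (suc n) ≈ Ψwith R y′ (suc n)
  Ψwith-cong n {y} {y′} y≈y′ = sumFT-cong 2 (suc n) {inner y} {inner y′} (λ ν 2≤ν _ →
    sumFT-cong 0 (ν ⊓ (suc n ∸ ν)) {term y ν} {term y′ ν} (λ k _ _ →
      *-congˡ (bellPartial-cong (suc n ∸ k) ν (λ i i≤ → y≈y′ i (ℕₚ.≤-trans i≤ (ℕₚ.∸-mono (s≤s (ℕₚ.m∸n≤m (suc n) k)) 2≤ν))))))
    where
    term : (ℕ → Carrier) → ℕ → ℕ → Carrier
    term z ν k = intR R (((ℤ.- ℤ.1ℤ) ℤ.^ suc ν) ℤ.* S₁ (suc ν) (suc k) ℤ.* ℤ.+ ff (suc n) k) * bellPartial R (suc n ∸ k) ν z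
    inner : (ℕ → Carrier) → ℕ → Carrier
    inner z ν = sumFT R 0 (ν ⊓ (suc n ∸ ν)) (term z ν)

  private
    n<ᵇn : ∀ n → (n ℕ.<ᵇ n) ≡ false
    n<ᵇn zero    = ≡.refl
    n<ᵇn (suc n) = n<ᵇn n

    n≡ᵇn : ∀ n → (n ≡ᵇ n) ≡ true
    n≡ᵇn zero    = ≡.refl
    n≡ᵇn (suc n) = n≡ᵇn n

  ψ-suc : ∀ x n → ψ R x (suc n) ≈ suc n · ψ R x n + (σ⋆ R x (suc n) + Ψ R x (suc n))
  ψ-suc x n = begin
    ψ R x (suc n)
      ≡⟨ unfold ⟩
    natMul R (suc n) (ψ R x n) + σ⋆ R x (suc n) + Ψwith R (ψupto R x n) (suc n)
      ≈⟨ +-cong (+-congʳ (reflexive (natMul≡· (suc n) _))) (Ψwith-cong n (λ i i≤n → reflexive (ψupto-stable x n i i≤n))) ⟩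
    suc n · ψ R x n + σ⋆ R x (suc n) + Ψ R x (suc n)
      ≈⟨ +-assoc _ _ _ ⟩
    suc n · ψ R x n + (σ⋆ R x (suc n) + Ψ R x (suc n)) ∎
    where
    unfold : ψ R x (suc n) ≡ natMul R (suc n) (ψ R x n) + σ⋆ R x (suc n) + Ψwith R (ψupto R x n) (suc n)
    unfold rewrite n<ᵇn n | n≡ᵇn n = ≡.refl

  ψ≈∑ : ∀ x n → ψ R x n ≈ ∑< n (λ i → ff n (n ∸ suc i) · (σ⋆ R x (suc i) + Ψ R x (suc i)))
  ψ≈∑ x zero    = refl
  ψ≈∑ x (suc n) = begin
    ψ R x (suc n)                          ≈⟨ ψ-suc x n ⟩
    suc n · ψ R x n + a n                  ≈⟨ +-congʳ (×-congʳ (suc n) (ψ≈∑ x n)) ⟩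
    suc n · ∑< n (λ i → ff n (n ∸ suc i) · a i) + a n
      ≈⟨ +-cong (trans (·-distrib-∑< n (suc n) _) (∑<-cong n (λ i i<n → ×-assocˡ (a i) (suc n) (ff n (n ∸ suc i)))))
                (sym (×-homo-1 (a n))) ⟩
    ∑< n (λ i → (suc n ℕ.* ff n (n ∸ suc i)) · a i) + 1 · a n
      ≈⟨ +-cong (∑<-cong n (λ i i<n → ×-congˡ (≡.sym (ff-suc n i i<n)))) (×-congˡ (≡.sym top)) ⟩
    ∑< n (λ i → ff (suc n) (n ∸ i) · a i) + ff (suc n) (n ∸ n) · a n
      ≈⟨ ∑<-last n (λ i → ff (suc n) (n ∸ i) · a i) ⟨
    ∑< (suc n) (λ i → ff (suc n) (n ∸ i) · a i) ∎
    where
    a : ℕ → Carrier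
    a i = σ⋆ R x (suc i) + Ψ R x (suc i)
    top : ff (suc n) (n ∸ n) ≡ 1
    top rewrite ℕₚ.n∸n≡0 n = ≡.refl

  ψ≈sumFT : ∀ x n → ψ R x n ≈ sumFT R 1 n (λ j → natMul R (ff n (n ∸ j)) (σ⋆ R x j + Ψ R x j))
  ψ≈sumFT x n = begin
    ψ R x n                                               ≈⟨ ψ≈∑ x n ⟩
    ∑< n (λ i → ff n (n ∸ suc i) · a (suc i))             ≈⟨ ∑<-cong′ n (λ i → reflexive (≡.sym (natMul≡· (ff n (n ∸ suc i)) (a (suc i))))) ⟩
    ∑< n (λ i → natMul R (ff n (n ∸ suc i)) (a (suc i)))  ≡⟨ sumFT≡∑< 1 n (λ j → natMul R (ff n (n ∸ j)) (a j)) ⟨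
    sumFT R 1 n (λ j → natMul R (ff n (n ∸ j)) (a j))     ∎
    where
    a : ℕ → Carrier
    a j = σ⋆ R x j + Ψ R x j

module Guards where

  ∧⇒ : ∀ {a b} → T (a ∧ b) → T a × T b
  ∧⇒ {a} {b} = Equivalence.to (Boolₚ.T-∧ {a} {b})

  ⇒∧ : ∀ {a b} → T a → T b → T (a ∧ b)
  ⇒∧ {a} {b} p q = Equivalence.from (Boolₚ.T-∧ {a} {b}) (p , q)

  ≤ᵇ∧≤ᵇ⇒ : ∀ a n j k → T ((a ≤ᵇ n) ∧ (j ≤ᵇ k)) → a ≤ n × j ≤ k
  ≤ᵇ∧≤ᵇ⇒ a n j k t = ℕₚ.≤ᵇ⇒≤ a n (proj₁ (∧⇒ t)) , ℕₚ.≤ᵇ⇒≤ j k (proj₂ (∧⇒ t))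

  ⇒≤ᵇ∧≤ᵇ : ∀ {a n j k} → a ≤ n → j ≤ k → T ((a ≤ᵇ n) ∧ (j ≤ᵇ k))
  ⇒≤ᵇ∧≤ᵇ a≤n j≤k = ⇒∧ (ℕₚ.≤⇒≤ᵇ a≤n) (ℕₚ.≤⇒≤ᵇ j≤k)

  +≡ᵇ : ∀ a w n → (a ℕ.+ w ≡ᵇ n) ≡ ((a ≤ᵇ n) ∧ (w ≡ᵇ n ∸ a))
  +≡ᵇ zero    w n       = ≡.refl
  +≡ᵇ (suc a) w zero    = ≡.refl
  +≡ᵇ (suc a) w (suc n) = ≡.trans (+≡ᵇ a w n) (≡.cong (_∧ (w ≡ᵇ n ∸ a)) (suc≤ᵇ a n))
    where
    suc≤ᵇ : ∀ a n → (a ≤ᵇ n) ≡ (suc a ≤ᵇ suc n)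
    suc≤ᵇ zero    n = ≡.refl
    suc≤ᵇ (suc a) n = ≡.refl

  take-swap : ∀ {a q n} → a ≤ n → q ≤ n ∸ a → q ≤ n × a ≤ n ∸ q
  take-swap {a} {q} {n} a≤n q≤n∸a = ℕₚ.m+n≤o⇒n≤o a a+q≤n , ℕₚ.m+n≤o⇒m≤o∸n a a+q≤n
    where
    a+q≤n : a ℕ.+ q ≤ n
    a+q≤n = ≡.subst (_≤ n) (ℕₚ.+-comm q a) (ℕₚ.m≤o∸n⇒m+n≤o q a≤n q≤n∸a)

  take-swapᵇ : ∀ a q n j l k → T (((a ≤ᵇ n) ∧ (j ≤ᵇ k)) ∧ ((q ≤ᵇ n ∸ a) ∧ (l ≤ᵇ k ∸ j)))
                             → T (((q ≤ᵇ n) ∧ (l ≤ᵇ k)) ∧ ((a ≤ᵇ n ∸ q) ∧ (j ≤ᵇ k ∸ l)))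
  take-swapᵇ a q n j l k t = ⇒∧ (⇒≤ᵇ∧≤ᵇ (proj₁ elements) (proj₁ parts)) (⇒≤ᵇ∧≤ᵇ (proj₂ elements) (proj₂ parts))
    where
    first = ≤ᵇ∧≤ᵇ⇒ a n j k (proj₁ (∧⇒ t))
    second = ≤ᵇ∧≤ᵇ⇒ q (n ∸ a) l (k ∸ j) (proj₂ (∧⇒ {(a ≤ᵇ n) ∧ (j ≤ᵇ k)} t))
    elements = take-swap (proj₁ first) (proj₁ second)
    parts = take-swap (proj₂ first) (proj₂ second)

open Guards

module RestrictedBell {c ℓ : Level} (R : CommutativeRing c ℓ) (y : ℕ → CommutativeRing.Carrier R) (b : ℕ) where
  open import Algebra.Properties.CommutativeSemigroup (CommutativeMonoid.commutativeSemigroup Boolₚ.∧-commutativeMonoid)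
    using () renaming (interchange to ∧-interchange)
  open CommutativeRing R
  open RingSums R
  open import Relation.Binary.Reasoning.Setoid setoid

  bellTerm : ℕ → List ℕ → Carrier
  bellTerm i js = bellCoeffFrom i js · monom R y i js

  -- bellSum i m n k sums bellTerm over the multiplicities (j_i, …, j_{i+m-1}) ∈ {0, …, b}^m of the parts
  -- of sizes i, …, i+m-1 of a partition of an n-set into k parts.
  bellSum : ℕ → ℕ → ℕ → ℕ → Carrier
  bellSum i m n k = ∑ᴸ (tuples m b) (λ js → when ((wsum i js ≡ᵇ n) ∧ (lsum js ≡ᵇ k)) (bellTerm i js))

  fits : ℕ → ℕ → ℕ → ℕ → Bool
  fits i n k j = (i ℕ.* j ≤ᵇ n) ∧ (j ≤ᵇ k)

  blocksTerm : ℕ → ℕ → ℕ → Carrier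
  blocksTerm i n j = ((n C (i ℕ.* j)) ℕ.* blocks i j) · pow R (y i) j

  -- the terms of bellSum i (suc m) n k with exactly j parts of size i
  firstParts : ℕ → ℕ → ℕ → ℕ → ℕ → Carrier
  firstParts i m n k j = when (fits i n k j) (blocksTerm i n j * bellSum (suc i) m (n ∸ i ℕ.* j) (k ∸ j))

  bellSum-suc : ∀ i m n k → bellSum i (suc m) n k ≈ ∑< (suc b) (firstParts i m n k)
  bellSum-suc i m n k = begin
    bellSum i (suc m) n k
      ≈⟨ ∑ᴸ-concatMap (suc b) (λ j → j) (λ j → map (j ∷_) (tuples m b)) summand ⟩
    ∑< (suc b) (λ j → ∑ᴸ (map (j ∷_) (tuples m b)) summand)
      ≈⟨ ∑<-cong′ (suc b) (λ j → trans (reflexive (∑ᴸ-map (tuples m b) (j ∷_) summand)) (first j)) ⟩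
    ∑< (suc b) (firstParts i m n k) ∎
    where
    summand : List ℕ → Carrier
    summand js = when ((wsum i js ≡ᵇ n) ∧ (lsum js ≡ᵇ k)) (bellTerm i js)
    rest : ℕ → List ℕ → Bool
    rest j js = (wsum (suc i) js ≡ᵇ n ∸ i ℕ.* j) ∧ (lsum js ≡ᵇ k ∸ j)
    guard : ∀ j js → ((wsum i (j ∷ js) ≡ᵇ n) ∧ (lsum (j ∷ js) ≡ᵇ k)) ≡ (fits i n k j ∧ rest j js)
    guard j js = ≡.trans (≡.cong₂ _∧_ (+≡ᵇ (i ℕ.* j) (wsum (suc i) js) n) (+≡ᵇ j (lsum js) k))
                         (∧-interchange (i ℕ.* j ≤ᵇ n) _ (j ≤ᵇ k) _)
    peel : ∀ j js → T (fits i n k j) → T (rest j js) → bellTerm i (j ∷ js) ≈ blocksTerm i n j * bellTerm (suc i) js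
    peel j js fit rst = begin
      bellTerm i (j ∷ js)
        ≈⟨ ·-* (((i ℕ.* j ℕ.+ wsum (suc i) js) C (i ℕ.* j)) ℕ.* blocks i j) (bellCoeffFrom (suc i) js)
               (pow R (y i) j) (monom R y (suc i) js) ⟨
      ((((i ℕ.* j ℕ.+ wsum (suc i) js) C (i ℕ.* j)) ℕ.* blocks i j) · pow R (y i) j) * bellTerm (suc i) js
        ≡⟨ ≡.cong (λ t → (((t C (i ℕ.* j)) ℕ.* blocks i j) · pow R (y i) j) * bellTerm (suc i) js) total ⟩
      blocksTerm i n j * bellTerm (suc i) js ∎
      where
      total : i ℕ.* j ℕ.+ wsum (suc i) js ≡ n
      total = ≡.trans (≡.cong (i ℕ.* j ℕ.+_) (ℕₚ.≡ᵇ⇒≡ (wsum (suc i) js) (n ∸ i ℕ.* j) (proj₁ (∧⇒ rst))))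
                      (ℕₚ.m+[n∸m]≡n (proj₁ (≤ᵇ∧≤ᵇ⇒ (i ℕ.* j) n j k fit)))
    first : ∀ j → ∑ᴸ (tuples m b) (λ js → summand (j ∷ js)) ≈ firstParts i m n k j
    first j = begin
      ∑ᴸ (tuples m b) (λ js → summand (j ∷ js))
        ≈⟨ ∑ᴸ-cong (tuples m b) (λ js → trans (reflexive (≡.trans (≡.cong (λ g → when g (bellTerm i (j ∷ js))) (guard j js))
                                                               (when-∧ (fits i n k j) (rest j js) _)))
             (when-cong (fits i n k j) (λ fit → trans (when-cong (rest j js) (peel j js fit))
                                                  (sym (*-when (rest j js) _ _))))) ⟩
      ∑ᴸ (tuples m b) (λ js → when (fits i n k j) (blocksTerm i n j * when (rest j js) (bellTerm (suc i) js)))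
        ≈⟨ when-∑ᴸ (tuples m b) (fits i n k j) _ ⟨
      when (fits i n k j) (∑ᴸ (tuples m b) (λ js → blocksTerm i n j * when (rest j js) (bellTerm (suc i) js)))
        ≈⟨ when-cong (fits i n k j) (λ _ → sym (*-distribˡ-∑ᴸ (tuples m b) (blocksTerm i n j) _)) ⟩
      when (fits i n k j) (blocksTerm i n j * bellSum (suc i) m (n ∸ i ℕ.* j) (k ∸ j)) ∎

  bellSum-nil : ∀ i n k → bellSum i 0 n k ≈ when ((0 ≡ᵇ n) ∧ (0 ≡ᵇ k)) 1#
  bellSum-nil i n k = trans (+-identityʳ _) (when-cong ((0 ≡ᵇ n) ∧ (0 ≡ᵇ k)) (λ _ → ×-homo-1 1#))

  bellSum-no-parts : ∀ i m n → bellSum (suc i) m n 0 ≈ when (0 ≡ᵇ n) 1#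
  bellSum-no-parts i zero    n = trans (bellSum-nil (suc i) n 0) (reflexive (≡.cong (λ g → when g 1#) (Boolₚ.∧-identityʳ (0 ≡ᵇ n))))
  bellSum-no-parts i (suc m) n = begin
    bellSum (suc i) (suc m) n 0
      ≈⟨ bellSum-suc (suc i) m n 0 ⟩
    firstParts (suc i) m n 0 0 + ∑< b (λ j → firstParts (suc i) m n 0 (suc j))
      ≈⟨ +-cong (no-blocks (suc i ℕ.* 0) (ℕₚ.*-zeroʳ (suc i)))
                (∑<-zero b {λ j → firstParts (suc i) m n 0 (suc j)} (λ j _ → when-false (fits (suc i) n 0 (suc j))
                  (λ fit → ℕₚ.1+n≰n (ℕₚ.≤-trans (proj₂ (≤ᵇ∧≤ᵇ⇒ (suc i ℕ.* suc j) n (suc j) 0 fit)) z≤n)))) ⟩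
    when (0 ≡ᵇ n) 1# + 0#
      ≈⟨ +-identityʳ _ ⟩
    when (0 ≡ᵇ n) 1# ∎
    where
    no-blocks : ∀ t → t ≡ 0 → when ((t ≤ᵇ n) ∧ true) (((n C t) ℕ.* blocks (suc i) 0) · pow R (y (suc i)) 0
                                                        * bellSum (suc (suc i)) m (n ∸ t) 0) ≈ when (0 ≡ᵇ n) 1#
    no-blocks .0 ≡.refl = trans (*-congʳ (×-homo-1 1#)) (trans (*-identityˡ _) (bellSum-no-parts (suc i) m n))

  bellSum-too-many-parts : ∀ i m n k → n < k → bellSum (suc i) m n k ≈ 0#
  bellSum-too-many-parts i zero    n (suc k) n<k =
    trans (bellSum-nil (suc i) n (suc k)) (when-false ((0 ≡ᵇ n) ∧ false) (λ t → proj₂ (∧⇒ {0 ≡ᵇ n} t)))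
  bellSum-too-many-parts i (suc m) n k       n<k = trans (bellSum-suc (suc i) m n k) (∑<-zero (suc b) (λ j _ →
    when-zero (fits (suc i) n k j) (λ fit → trans (*-congˡ {blocksTerm (suc i) n j} (bellSum-too-many-parts (suc i) m _ _ (fewer j fit)))
                                              (zeroʳ (blocksTerm (suc i) n j)))))
    where
    fewer : ∀ j → T (fits (suc i) n k j) → n ∸ suc i ℕ.* j < k ∸ j
    fewer j fit = ℕₚ.≤-<-trans (ℕₚ.∸-monoʳ-≤ n (ℕₚ.m≤m+n j (i ℕ.* j)))
                               (ℕₚ.∸-monoˡ-< n<k (ℕₚ.≤-trans (ℕₚ.m≤m+n j (i ℕ.* j)) (proj₁ (≤ᵇ∧≤ᵇ⇒ (suc i ℕ.* j) n j k fit))))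

  -- Once n < m + k(i+1), parts of size i+1+m cannot occur among k parts of total size n.
  bellSum-stable : ∀ m i n k → n < m ℕ.+ k ℕ.* suc i → bellSum (suc i) (suc m) n k ≈ bellSum (suc i) m n k
  bellSum-stable m       i n zero    _  = trans (bellSum-no-parts i (suc m) n) (sym (bellSum-no-parts i m n))
  bellSum-stable zero    i n (suc k) n< = begin
    bellSum (suc i) 1 n (suc k)                ≈⟨ bellSum-suc (suc i) 0 n (suc k) ⟩
    ∑< (suc b) (firstParts (suc i) 0 n (suc k)) ≈⟨ ∑<-zero (suc b) (λ j _ → when-zero (fits (suc i) n (suc k) j) (λ fit →
                                                     trans (*-congˡ {blocksTerm (suc i) n j} (no-room j fit)) (zeroʳ _))) ⟩
    0#                                         ≈⟨ when-false ((0 ≡ᵇ n) ∧ false) (λ t → proj₂ (∧⇒ {0 ≡ᵇ n} t)) ⟨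
    when ((0 ≡ᵇ n) ∧ (0 ≡ᵇ suc k)) 1#          ≈⟨ bellSum-nil (suc i) n (suc k) ⟨
    bellSum (suc i) 0 n (suc k)                ∎
    where
    no-room : ∀ j → T (fits (suc i) n (suc k) j) → bellSum (suc (suc i)) 0 (n ∸ suc i ℕ.* j) (suc k ∸ j) ≈ 0#
    no-room j fit = trans (bellSum-nil (suc (suc i)) (n ∸ suc i ℕ.* j) (suc k ∸ j))
                          (when-false ((0 ≡ᵇ n ∸ suc i ℕ.* j) ∧ (0 ≡ᵇ suc k ∸ j)) not-exhausted)
      where
      not-exhausted : ¬ T ((0 ≡ᵇ n ∸ suc i ℕ.* j) ∧ (0 ≡ᵇ suc k ∸ j))
      not-exhausted t = ℕₚ.<⇒≱ n< (≡.subst (_≤ n) (ℕₚ.*-comm (suc i) (suc k)) (ℕₚ.≤-trans (ℕₚ.*-monoʳ-≤ (suc i) k<j) Ij≤n))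
        where
        k<j = ℕₚ.m∸n≡0⇒m≤n (≡.sym (ℕₚ.≡ᵇ⇒≡ 0 (suc k ∸ j) (proj₂ (∧⇒ {0 ≡ᵇ n ∸ suc i ℕ.* j} t))))
        Ij≤n = proj₁ (≤ᵇ∧≤ᵇ⇒ (suc i ℕ.* j) n j (suc k) fit)
  bellSum-stable (suc m) i n (suc k) n< = begin
    bellSum (suc i) (suc (suc m)) n (suc k)          ≈⟨ bellSum-suc (suc i) (suc m) n (suc k) ⟩
    ∑< (suc b) (firstParts (suc i) (suc m) n (suc k)) ≈⟨ ∑<-cong′ (suc b) (λ j → when-cong (fits (suc i) n (suc k) j) (λ fit →
                                                           *-congˡ {blocksTerm (suc i) n j} (shorter j fit))) ⟩
    ∑< (suc b) (firstParts (suc i) m n (suc k))       ≈⟨ bellSum-suc (suc i) m n (suc k) ⟨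
    bellSum (suc i) (suc m) n (suc k)                ∎
    where
    shorter : ∀ j → T (fits (suc i) n (suc k) j) →
              bellSum (suc (suc i)) (suc m) (n ∸ suc i ℕ.* j) (suc k ∸ j) ≈ bellSum (suc (suc i)) m (n ∸ suc i ℕ.* j) (suc k ∸ j)
    shorter j fit with suc k ∸ j in k-j
    ... | zero  = trans (bellSum-no-parts (suc i) (suc m) _) (sym (bellSum-no-parts (suc i) m _))
    ... | suc r = bellSum-stable m (suc i) (n ∸ suc i ℕ.* j) (suc r) bound
      where
      Ij≤n : suc i ℕ.* j ≤ n
      Ij≤n = proj₁ (≤ᵇ∧≤ᵇ⇒ (suc i ℕ.* j) n j (suc k) fit)
      k≡j+r : suc k ≡ j ℕ.+ suc r
      k≡j+r = ≡.trans (≡.sym (ℕₚ.m+[n∸m]≡n (proj₂ (≤ᵇ∧≤ᵇ⇒ (suc i ℕ.* j) n j (suc k) fit)))) (≡.cong (j ℕ.+_) k-j)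
      split : ∀ m j r i → suc m ℕ.+ (j ℕ.+ suc r) ℕ.* suc i ≡ suc i ℕ.* j ℕ.+ (suc m ℕ.+ suc r ℕ.* suc i)
      split = solve-∀
      widen : ∀ m r i → m ℕ.+ suc r ℕ.* suc (suc i) ≡ (suc m ℕ.+ suc r ℕ.* suc i) ℕ.+ r
      widen = solve-∀
      bound : n ∸ suc i ℕ.* j < m ℕ.+ suc r ℕ.* suc (suc i)
      bound = ℕₚ.<-≤-trans
        (ℕₚ.+-cancelˡ-< (suc i ℕ.* j) _ _ (≡.subst₂ _<_ (≡.sym (ℕₚ.m+[n∸m]≡n Ij≤n))
                                                      (≡.trans (≡.cong (λ t → suc m ℕ.+ t ℕ.* suc i) k≡j+r) (split m j r i)) n<))
        (≡.subst (suc m ℕ.+ suc r ℕ.* suc i ≤_) (≡.sym (widen m r i)) (ℕₚ.m≤m+n _ r))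

  removable : ℕ → ℕ → ℕ → Bool
  removable q n k = (q ≤ᵇ n) ∧ (1 ≤ᵇ k)

  markedCoeff : ℕ → ℕ → Carrier
  markedCoeff n q = (q ℕ.* (n C q)) · y q

  -- the terms of n · bellSum i m n k in which a marked element of the n-set lies in a part of size q
  markedPart : ℕ → ℕ → ℕ → ℕ → ℕ → Carrier
  markedPart m i n k q = when (removable q n k) (markedCoeff n q * bellSum i m (n ∸ q) (k ∸ 1))

  -- the part of n · firstParts i m n k j in which the marked element lies in one of the j parts of size i
  markedFirst : ℕ → ℕ → ℕ → ℕ → ℕ → Carrier
  markedFirst i m n k j = when (fits i n k j) ((i ℕ.* j) · blocksTerm i n j * bellSum (suc i) m (n ∸ i ℕ.* j) (k ∸ j))

  -- the part in which it lies in a later part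
  markedLater : ℕ → ℕ → ℕ → ℕ → ℕ → Carrier
  markedLater i m n k j = when (fits i n k j) (blocksTerm i n j * ((n ∸ i ℕ.* j) · bellSum (suc i) m (n ∸ i ℕ.* j) (k ∸ j)))

  ·-firstParts : ∀ i m n k j → n · firstParts i m n k j ≈ markedFirst i m n k j + markedLater i m n k j
  ·-firstParts i m n k j =
    trans (·-when (fits i n k j) n _) (trans (when-cong (fits i n k j) split) (when-+ (fits i n k j) _ _))
    where
    A = blocksTerm i n j
    L = bellSum (suc i) m (n ∸ i ℕ.* j) (k ∸ j)
    split : T (fits i n k j) → n · (A * L) ≈ (i ℕ.* j) · A * L + A * ((n ∸ i ℕ.* j) · L)
    split fit = begin
      n · (A * L)                                   ≡⟨ ≡.cong (_· (A * L)) (ℕₚ.m+[n∸m]≡n (proj₁ (≤ᵇ∧≤ᵇ⇒ (i ℕ.* j) n j k fit))) ⟨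
      (i ℕ.* j ℕ.+ (n ∸ i ℕ.* j)) · (A * L)         ≈⟨ ×-homo-+ (A * L) (i ℕ.* j) (n ∸ i ℕ.* j) ⟩
      (i ℕ.* j) · (A * L) + (n ∸ i ℕ.* j) · (A * L) ≈⟨ +-cong (sym (×-assoc-* (i ℕ.* j) A L)) (sym (×-comm-* (n ∸ i ℕ.* j) A L)) ⟩
      (i ℕ.* j) · A * L + A * ((n ∸ i ℕ.* j) · L)   ∎

  markedFirst-suc : ∀ m i n k j → markedFirst (suc i) m n k (suc j)
    ≈ when (removable (suc i) n k) (markedCoeff n (suc i) * firstParts (suc i) m (n ∸ suc i) (k ∸ 1) j)
  markedFirst-suc m i n k j = begin
    markedFirst I m n k (suc j)
      ≈⟨ when-⇔ (fits I n k (suc j)) (removable I n k ∧ fits I (n ∸ I) (k ∸ 1) j) to from value ⟩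
    when (removable I n k ∧ fits I (n ∸ I) (k ∸ 1) j) (markedCoeff n I * (blocksTerm I (n ∸ I) j * L))
      ≈⟨ when-*-when (removable I n k) (fits I (n ∸ I) (k ∸ 1) j) (markedCoeff n I) _ ⟨
    when (removable I n k) (markedCoeff n I * firstParts I m (n ∸ I) (k ∸ 1) j) ∎
    where
    I = suc i
    L = bellSum (suc I) m (n ∸ I ∸ I ℕ.* j) (k ∸ 1 ∸ j)
    I[1+j]≡I+Ij : I ℕ.* suc j ≡ I ℕ.+ I ℕ.* j
    I[1+j]≡I+Ij = ℕₚ.*-suc I j
    to : T (fits I n k (suc j)) → T (removable I n k ∧ fits I (n ∸ I) (k ∸ 1) j)
    to fit = ⇒∧ (⇒≤ᵇ∧≤ᵇ (ℕₚ.m+n≤o⇒m≤o I I+Ij≤n) (ℕₚ.≤-trans (s≤s z≤n) 1+j≤k))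
                (⇒≤ᵇ∧≤ᵇ (ℕₚ.m+n≤o⇒m≤o∸n (I ℕ.* j) (≡.subst (_≤ n) (ℕₚ.+-comm I (I ℕ.* j)) I+Ij≤n))
                        (ℕₚ.m+n≤o⇒m≤o∸n j (≡.subst (_≤ k) (ℕₚ.+-comm 1 j) 1+j≤k)))
      where
      I+Ij≤n = ≡.subst (_≤ n) I[1+j]≡I+Ij (proj₁ (≤ᵇ∧≤ᵇ⇒ (I ℕ.* suc j) n (suc j) k fit))
      1+j≤k = proj₂ (≤ᵇ∧≤ᵇ⇒ (I ℕ.* suc j) n (suc j) k fit)
    from : T (removable I n k ∧ fits I (n ∸ I) (k ∸ 1) j) → T (fits I n k (suc j))
    from t = ⇒≤ᵇ∧≤ᵇ (≡.subst (_≤ n) (≡.sym (≡.trans I[1+j]≡I+Ij (ℕₚ.+-comm I (I ℕ.* j))))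
                              (ℕₚ.m≤o∸n⇒m+n≤o (I ℕ.* j) (proj₁ I≤n,1≤k) (proj₁ Ij≤,j≤)))
                    (≡.subst (_≤ k) (ℕₚ.+-comm j 1) (ℕₚ.m≤o∸n⇒m+n≤o j (proj₂ I≤n,1≤k) (proj₂ Ij≤,j≤)))
      where
      I≤n,1≤k = ≤ᵇ∧≤ᵇ⇒ I n 1 k (proj₁ (∧⇒ t))
      Ij≤,j≤ = ≤ᵇ∧≤ᵇ⇒ (I ℕ.* j) (n ∸ I) j (k ∸ 1) (proj₂ (∧⇒ {removable I n k} t))
    value : T (fits I n k (suc j)) → (I ℕ.* suc j) · blocksTerm I n (suc j) * bellSum (suc I) m (n ∸ I ℕ.* suc j) (k ∸ suc j)
                                     ≈ markedCoeff n I * (blocksTerm I (n ∸ I) j * L)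
    value fit = begin
      (I ℕ.* suc j) · blocksTerm I n (suc j) * bellSum (suc I) m (n ∸ I ℕ.* suc j) (k ∸ suc j)
        ≈⟨ *-cong (×-assocˡ (pow R (y I) (suc j)) (I ℕ.* suc j) ((n C (I ℕ.* suc j)) ℕ.* blocks I (suc j)))
                  (reflexive (≡.cong₂ (bellSum (suc I) m) rest-size rest-parts)) ⟩
      ((I ℕ.* suc j) ℕ.* ((n C (I ℕ.* suc j)) ℕ.* blocks I (suc j))) · (y I * pow R (y I) j) * L
        ≡⟨ ≡.cong (λ t → t · (y I * pow R (y I) j) * L)
                  (marked-block i j n (≡.subst (_≤ n) I[1+j]≡I+Ij (proj₁ (≤ᵇ∧≤ᵇ⇒ (I ℕ.* suc j) n (suc j) k fit)))) ⟩
      ((I ℕ.* (n C I)) ℕ.* (((n ∸ I) C (I ℕ.* j)) ℕ.* blocks I j)) · (y I * pow R (y I) j) * L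
        ≈⟨ *-congʳ (·-* (I ℕ.* (n C I)) _ (y I) (pow R (y I) j)) ⟨
      markedCoeff n I * blocksTerm I (n ∸ I) j * L
        ≈⟨ *-assoc _ _ _ ⟩
      markedCoeff n I * (blocksTerm I (n ∸ I) j * L) ∎
      where
      rest-size : n ∸ I ℕ.* suc j ≡ n ∸ I ∸ I ℕ.* j
      rest-size = ≡.trans (≡.cong (n ∸_) I[1+j]≡I+Ij) (≡.sym (ℕₚ.∸-+-assoc n I (I ℕ.* j)))
      rest-parts : k ∸ suc j ≡ k ∸ 1 ∸ j
      rest-parts = ≡.sym (ℕₚ.∸-+-assoc k 1 j)

  ∑-markedFirst : ∀ m i n k → n ≤ b → ∑< (suc b) (markedFirst (suc i) m n k) ≈ markedPart (suc m) (suc i) n k (suc i)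
  ∑-markedFirst m i n k n≤b = begin
    ∑< (suc b) (markedFirst I m n k)
      ≈⟨ +-cong none (∑<-cong′ b (markedFirst-suc m i n k)) ⟩
    0# + ∑< b (λ j → when (removable I n k) (cI * firstParts I m (n ∸ I) (k ∸ 1) j))
      ≈⟨ trans (+-identityˡ _) (sym (when-∑< (removable I n k) b _)) ⟩
    when (removable I n k) (∑< b (λ j → cI * firstParts I m (n ∸ I) (k ∸ 1) j))
      ≈⟨ when-cong (removable I n k) (λ rem → trans (sym (*-distribˡ-∑< b cI _)) (*-congˡ (sym (all-parts rem)))) ⟩
    markedPart (suc m) I n k I ∎
    where
    I = suc i
    cI = markedCoeff n I
    none : markedFirst I m n k 0 ≈ 0#
    none = when-zero (fits I n k 0) (λ _ → trans (*-congʳ (×-congˡ (ℕₚ.*-zeroʳ I))) (zeroˡ _))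
    -- there is no room for b parts of size I besides a marked one
    all-parts : T (removable I n k) → bellSum I (suc m) (n ∸ I) (k ∸ 1) ≈ ∑< b (firstParts I m (n ∸ I) (k ∸ 1))
    all-parts rem = trans (bellSum-suc I m (n ∸ I) (k ∸ 1))
                          (trans (∑<-last b _) (trans (+-congˡ (when-false (fits I (n ∸ I) (k ∸ 1) b) too-many)) (+-identityʳ _)))
      where
      too-many : ¬ T (fits I (n ∸ I) (k ∸ 1) b)
      too-many fit = ℕₚ.<⇒≱ (ℕₚ.≤-<-trans (ℕₚ.m≤n*m b I) (ℕₚ.m<m+n (I ℕ.* b) (s≤s z≤n)))
                            (ℕₚ.≤-trans (ℕₚ.m≤o∸n⇒m+n≤o (I ℕ.* b) (proj₁ (≤ᵇ∧≤ᵇ⇒ I n 1 k rem))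
                                                         (proj₁ (≤ᵇ∧≤ᵇ⇒ (I ℕ.* b) (n ∸ I) b (k ∸ 1) fit)))
                                        n≤b)

  -- Marking a point outside the parts of size I commutes with splitting off those parts.
  markedPart-firstParts : ∀ m I n k q j →
    when (fits I n k j) (blocksTerm I n j * markedPart m (suc I) (n ∸ I ℕ.* j) (k ∸ j) q)
    ≈ when (removable q n k) (markedCoeff n q * firstParts I m (n ∸ q) (k ∸ 1) j)
  markedPart-firstParts m I n k q j = begin
    when (fits I n k j) (blocksTerm I n j * markedPart m (suc I) (n ∸ a) (k ∸ j) q)
      ≈⟨ when-*-when (fits I n k j) (removable q (n ∸ a) (k ∸ j)) (blocksTerm I n j) _ ⟩
    when (fits I n k j ∧ removable q (n ∸ a) (k ∸ j)) (blocksTerm I n j * (markedCoeff (n ∸ a) q * L₁))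
      ≈⟨ when-⇔ (fits I n k j ∧ removable q (n ∸ a) (k ∸ j)) (removable q n k ∧ fits I (n ∸ q) (k ∸ 1) j)
                (take-swapᵇ a q n j 1 k) (take-swapᵇ q a n 1 j k) value ⟩
    when (removable q n k ∧ fits I (n ∸ q) (k ∸ 1) j) (markedCoeff n q * (blocksTerm I (n ∸ q) j * L₂))
      ≈⟨ when-*-when (removable q n k) (fits I (n ∸ q) (k ∸ 1) j) (markedCoeff n q) _ ⟨
    when (removable q n k) (markedCoeff n q * firstParts I m (n ∸ q) (k ∸ 1) j) ∎
    where
    a = I ℕ.* j
    L₁ = bellSum (suc I) m (n ∸ a ∸ q) (k ∸ j ∸ 1)
    L₂ = bellSum (suc I) m (n ∸ q ∸ a) (k ∸ 1 ∸ j)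
    value : T (fits I n k j ∧ removable q (n ∸ a) (k ∸ j)) →
            blocksTerm I n j * (markedCoeff (n ∸ a) q * L₁) ≈ markedCoeff n q * (blocksTerm I (n ∸ q) j * L₂)
    value t = begin
      blocksTerm I n j * (markedCoeff (n ∸ a) q * L₁)
        ≈⟨ *-assoc _ _ _ ⟨
      blocksTerm I n j * markedCoeff (n ∸ a) q * L₁
        ≈⟨ *-congʳ (·-* ((n C a) ℕ.* blocks I j) (q ℕ.* ((n ∸ a) C q)) (pow R (y I) j) (y q)) ⟩
      (((n C a) ℕ.* blocks I j) ℕ.* (q ℕ.* ((n ∸ a) C q))) · (pow R (y I) j * y q) * L₁
        ≈⟨ *-cong (×-cong (nCa*c*[q*[n∸a]Cq]≡[q*nCq]*[[n∸q]Ca*c] n a q (blocks I j) a+q≤n) (*-comm _ _))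
                  (reflexive (≡.cong₂ (bellSum (suc I) m) (n∸k∸l≡n∸l∸k n a q) (n∸k∸l≡n∸l∸k k j 1))) ⟩
      ((q ℕ.* (n C q)) ℕ.* (((n ∸ q) C a) ℕ.* blocks I j)) · (y q * pow R (y I) j) * L₂
        ≈⟨ *-congʳ (·-* (q ℕ.* (n C q)) (((n ∸ q) C a) ℕ.* blocks I j) (y q) (pow R (y I) j)) ⟨
      markedCoeff n q * blocksTerm I (n ∸ q) j * L₂
        ≈⟨ *-assoc _ _ _ ⟩
      markedCoeff n q * (blocksTerm I (n ∸ q) j * L₂) ∎
      where
      swapped = take-swapᵇ a q n j 1 k t
      a+q≤n : a ℕ.+ q ≤ n
      a+q≤n = ℕₚ.m≤o∸n⇒m+n≤o a (proj₁ (≤ᵇ∧≤ᵇ⇒ q n 1 k (proj₁ (∧⇒ swapped))))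
                (proj₁ (≤ᵇ∧≤ᵇ⇒ a (n ∸ q) j (k ∸ 1) (proj₂ (∧⇒ {removable q n k} swapped))))

  markedPart-suc : ∀ m I n k q → markedPart (suc m) I n k q
    ≈ ∑< (suc b) (λ j → when (fits I n k j) (blocksTerm I n j * markedPart m (suc I) (n ∸ I ℕ.* j) (k ∸ j) q))
  markedPart-suc m I n k q = begin
    markedPart (suc m) I n k q
      ≈⟨ when-cong (removable q n k) (λ _ → trans (*-congˡ (bellSum-suc I m (n ∸ q) (k ∸ 1)))
                                                 (*-distribˡ-∑< (suc b) (markedCoeff n q) (firstParts I m (n ∸ q) (k ∸ 1)))) ⟩
    when (removable q n k) (∑< (suc b) (λ j → markedCoeff n q * firstParts I m (n ∸ q) (k ∸ 1) j))
      ≈⟨ when-∑< (removable q n k) (suc b) (λ j → markedCoeff n q * firstParts I m (n ∸ q) (k ∸ 1) j) ⟩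
    ∑< (suc b) (λ j → when (removable q n k) (markedCoeff n q * firstParts I m (n ∸ q) (k ∸ 1) j))
      ≈⟨ ∑<-cong′ (suc b) (λ j → sym (markedPart-firstParts m I n k q j)) ⟩
    ∑< (suc b) (λ j → when (fits I n k j) (blocksTerm I n j * markedPart m (suc I) (n ∸ I ℕ.* j) (k ∸ j) q)) ∎

  -- Counting partitions with a marked point by the size of the part containing it.
  euler : ∀ m i n k → n ≤ b → n · bellSum (suc i) m n k ≈ ∑< m (λ p → markedPart m (suc i) n k (suc i ℕ.+ p))
  euler zero    i zero    k _   = refl
  euler zero    i (suc n) k _   = trans (×-congʳ (suc n) (bellSum-nil (suc i) (suc n) k)) (·-zeroʳ (suc n))
  euler (suc m) i n       k n≤b = begin
    n · bellSum I (suc m) n k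
      ≈⟨ trans (×-congʳ n (bellSum-suc I m n k)) (·-distrib-∑< (suc b) n (firstParts I m n k)) ⟩
    ∑< (suc b) (λ j → n · firstParts I m n k j)
      ≈⟨ trans (∑<-cong′ (suc b) (·-firstParts I m n k)) (∑<-distrib-+ (suc b) (markedFirst I m n k) (markedLater I m n k)) ⟩
    ∑< (suc b) (markedFirst I m n k) + ∑< (suc b) (markedLater I m n k)
      ≈⟨ +-cong (∑-markedFirst m i n k n≤b) later ⟩
    markedPart (suc m) I n k I + ∑< m (λ p → markedPart (suc m) I n k (I ℕ.+ suc p))
      ≡⟨ ≡.cong (λ t → markedPart (suc m) I n k t + ∑< m (λ p → markedPart (suc m) I n k (I ℕ.+ suc p)))
                (ℕₚ.+-identityʳ I) ⟨
    ∑< (suc m) (λ p → markedPart (suc m) I n k (I ℕ.+ p)) ∎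
    where
    I = suc i
    M : ℕ → ℕ → Carrier
    M j p = markedPart m (suc I) (n ∸ I ℕ.* j) (k ∸ j) (suc I ℕ.+ p)
    later : ∑< (suc b) (markedLater I m n k) ≈ ∑< m (λ p → markedPart (suc m) I n k (I ℕ.+ suc p))
    later = begin
      ∑< (suc b) (markedLater I m n k)
        ≈⟨ ∑<-cong′ (suc b) (λ j → when-cong (fits I n k j) (λ _ → *-congˡ {blocksTerm I n j}
             (euler m I (n ∸ I ℕ.* j) (k ∸ j) (ℕₚ.≤-trans (ℕₚ.m∸n≤m n (I ℕ.* j)) n≤b)))) ⟩
      ∑< (suc b) (λ j → when (fits I n k j) (blocksTerm I n j * ∑< m (M j)))
        ≈⟨ ∑<-cong′ (suc b) (λ j → trans (when-cong (fits I n k j) (λ _ → *-distribˡ-∑< m (blocksTerm I n j) (M j)))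
                                         (when-∑< (fits I n k j) m _)) ⟩
      ∑< (suc b) (λ j → ∑< m (λ p → when (fits I n k j) (blocksTerm I n j * M j p)))
        ≈⟨ ∑<-comm (suc b) m (λ j p → when (fits I n k j) (blocksTerm I n j * M j p)) ⟩
      ∑< m (λ p → ∑< (suc b) (λ j → when (fits I n k j) (blocksTerm I n j * M j p)))
        ≈⟨ ∑<-cong′ m (λ p → trans (sym (markedPart-suc m I n k (suc I ℕ.+ p)))
                                   (reflexive (≡.cong (markedPart (suc m) I n k) (≡.sym (ℕₚ.+-suc I p))))) ⟩
      ∑< m (λ p → markedPart (suc m) I n k (I ℕ.+ suc p)) ∎

  bellSum-stable* : ∀ d m n k → n < m ℕ.+ k ℕ.* 1 → bellSum 1 (d ℕ.+ m) n k ≈ bellSum 1 m n k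
  bellSum-stable* zero    m n k n< = refl
  bellSum-stable* (suc d) m n k n< =
    trans (bellSum-stable (d ℕ.+ m) 0 n k (ℕₚ.<-≤-trans n< (ℕₚ.+-monoˡ-≤ (k ℕ.* 1) (ℕₚ.m≤n+m m d)))) (bellSum-stable* d m n k n<)

  bellPartial≈bellSum : ∀ k → k < b → bellPartial R b (suc k) y ≈ bellSum 1 b b (suc k)
  bellPartial≈bellSum k k<b = begin
    bellPartial R b (suc k) y
      ≈⟨ BellCongruence.bellPartial≈∑ᴸ R b (suc k) y ⟩
    ∑ᴸ (tuples (b ∸ k) b) (BellCongruence.bellSummand R b (suc k) y)
      ≈⟨ ∑ᴸ-cong (tuples (b ∸ k) b) (λ js → when-cong ((wsum 1 js ≡ᵇ b) ∧ (lsum js ≡ᵇ suc k)) (λ t →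
           ×-congˡ (bellCoeff≡bellCoeffFrom b js (ℕₚ.≡ᵇ⇒≡ (wsum 1 js) b (proj₁ (∧⇒ t)))))) ⟩
    bellSum 1 (b ∸ k) b (suc k)
      ≈⟨ bellSum-stable* k (b ∸ k) b (suc k) b< ⟨
    bellSum 1 (k ℕ.+ (b ∸ k)) b (suc k)
      ≡⟨ ≡.cong (λ l → bellSum 1 l b (suc k)) (ℕₚ.m+[n∸m]≡n (ℕₚ.<⇒≤ k<b)) ⟩
    bellSum 1 b b (suc k) ∎
    where
    b< : b < (b ∸ k) ℕ.+ suc k ℕ.* 1
    b< = ≡.subst (b <_) (≡.sym (≡.trans (≡.cong ((b ∸ k) ℕ.+_) (ℕₚ.*-identityʳ (suc k)))
                                (≡.trans (ℕₚ.+-suc (b ∸ k) k) (≡.cong suc (ℕₚ.m∸n+n≡m (ℕₚ.<⇒≤ k<b)))))) (ℕₚ.n<1+n b)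

module LogarithmicBell {c ℓ : Level} (R : CommutativeRing c ℓ) (torsionFree : RingSums.TorsionFree R) where
  open CommutativeRing R
  open RingSums R
  open import Relation.Binary.Reasoning.Setoid setoid
  open import Algebra.Properties.Ring ring using (-‿distribˡ-*; -0#≈0#)

  -- The sequence y_q = -(q-1)! has exponential generating function log (1 - t).
  logCoeff : ℕ → Carrier
  logCoeff q = - (((q ∸ 1) !) · 1#)

  -- For N ≥ 2 the terms q = N - 1 and q = N of the sum are N! u_1 + N! u_0 = 0; the others vanish inductively.
  recurrence-vanishes : ∀ (u : ℕ → Carrier) n → u 0 ≈ 1# →
    (∀ N → N ≤ n → N · u N ≈ - ∑< N (λ p → (N P suc p) · u (N ∸ suc p))) →
    ∀ N → 2 ≤ N → N ≤ n → u N ≈ 0#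
  recurrence-vanishes u n u0 rec = <-rec (λ N → 2 ≤ N → N ≤ n → u N ≈ 0#) step
    where
    u1 : 1 ≤ n → u 1 ≈ - 1#
    u1 1≤n = begin
      u 1                      ≈⟨ ×-homo-1 (u 1) ⟨
      1 · u 1                  ≈⟨ rec 1 1≤n ⟩
      - ((1 P 1) · u 0 + 0#)   ≈⟨ -‿cong (trans (+-identityʳ _) (trans (×-homo-1 _) u0)) ⟩
      - 1#                     ∎
    step : ∀ N → (∀ {M} → M < N → 2 ≤ M → M ≤ n → u M ≈ 0#) → 2 ≤ N → N ≤ n → u N ≈ 0#
    step (suc (suc t)) ih (s≤s (s≤s z≤n)) N≤n = torsionFree (suc t) (u N) (begin
      N · u N
        ≈⟨ rec N N≤n ⟩
      - ∑< (suc (suc t)) f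
        ≈⟨ -‿cong (trans (∑<-last (suc t) f) (+-congʳ (∑<-last t f))) ⟩
      - (∑< t f + f t + f (suc t))
        ≈⟨ -‿cong (+-cong (+-cong (∑<-zero t early) second-last) last) ⟩
      - (0# + (N !) · (- 1#) + (N !) · 1#)
        ≈⟨ -‿cong (trans (+-congʳ (+-identityˡ _)) (trans (+-congʳ (·-neg (N !) 1#)) (-‿inverseˡ _))) ⟩
      - 0#
        ≈⟨ -0#≈0# ⟩
      0# ∎)
      where
      N = suc (suc t)
      f : ℕ → Carrier
      f p = (N P suc p) · u (N ∸ suc p)
      early : ∀ p → p < t → f p ≈ 0#
      early p p<t = trans (×-congʳ (N P suc p) (ih (s≤s (ℕₚ.m∸n≤m (suc t) p))
                                                  two≤ (ℕₚ.≤-trans (ℕₚ.m∸n≤m N (suc p)) N≤n)))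
                          (·-zeroʳ (N P suc p))
        where
        two≤ : 2 ≤ N ∸ suc p
        two≤ = ≡.subst (2 ≤_) (≡.sym (ℕₚ.+-∸-assoc 1 (ℕₚ.<⇒≤ p<t))) (s≤s (ℕₚ.m<n⇒0<n∸m p<t))
      second-last : f t ≈ (N !) · (- 1#)
      second-last = begin
        (N P suc t) · u (suc t ∸ t) ≡⟨ ≡.cong₂ (λ a m → a · u m) ([1+n]Pn≡[1+n]! (suc t)) (ℕₚ.m+n∸n≡m 1 t) ⟩
        (N !) · u 1                 ≈⟨ ×-congʳ (N !) (u1 (ℕₚ.≤-trans (s≤s z≤n) N≤n)) ⟩
        (N !) · (- 1#)              ∎
      last : f (suc t) ≈ (N !) · 1#
      last = begin
        (N P N) · u (N ∸ N) ≡⟨ ≡.cong₂ (λ a m → a · u m) (nPn≡n! N) (ℕₚ.n∸n≡0 N) ⟩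
        (N !) · u 0         ≈⟨ ×-congʳ (N !) u0 ⟩
        (N !) · 1#          ∎

  module _ (n : ℕ) where
    open RestrictedBell R logCoeff n

    markedCoeff-logCoeff : ∀ N q → 1 ≤ q → q ≤ N → markedCoeff N q ≈ - ((N P q) · 1#)
    markedCoeff-logCoeff N (suc p) _ q≤N = begin
      (suc p ℕ.* (N C suc p)) · (- ((p !) · 1#)) ≈⟨ ·-neg (suc p ℕ.* (N C suc p)) ((p !) · 1#) ⟩
      - ((suc p ℕ.* (N C suc p)) · ((p !) · 1#)) ≈⟨ -‿cong (×-assocˡ 1# (suc p ℕ.* (N C suc p)) (p !)) ⟩
      - ((suc p ℕ.* (N C suc p) ℕ.* p !) · 1#)   ≡⟨ ≡.cong (λ a → - (a · 1#)) ([1+k]*nC[1+k]*k!≡nP[1+k] N p q≤N) ⟩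
      - ((N P suc p) · 1#)                       ∎

    -- the complete Bell sum, with parts of size and multiplicity at most n
    completeSum : ℕ → Carrier
    completeSum N = ∑< (suc n) (bellSum 1 n N)

    completeSum-zero : completeSum 0 ≈ 1#
    completeSum-zero = trans (+-cong (bellSum-no-parts 0 n 0) (∑<-zero n (λ k _ → bellSum-too-many-parts 0 n 0 (suc k) (s≤s z≤n))))
                             (+-identityʳ 1#)

    -- N - q < n points cannot form n parts.
    completeSum-below : ∀ N q → 1 ≤ q → q ≤ N → N ≤ n → ∑< n (bellSum 1 n (N ∸ q)) ≈ completeSum (N ∸ q)
    completeSum-below N q 1≤q q≤N N≤n = sym (trans (∑<-last n (bellSum 1 n (N ∸ q)))
      (trans (+-congˡ (bellSum-too-many-parts 0 n (N ∸ q) n (ℕₚ.<-≤-trans (ℕₚ.∸-monoʳ-< 1≤q q≤N) N≤n))) (+-identityʳ _)))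

    ∑-markedPart : ∀ N p → N ≤ n →
      ∑< (suc n) (λ k → markedPart n 1 N k (suc p)) ≈ when (suc p ≤ᵇ N) (- ((N P suc p) · completeSum (N ∸ suc p)))
    ∑-markedPart N p N≤n = begin
      markedPart n 1 N 0 q + ∑< n (λ k → markedPart n 1 N (suc k) q)
        ≈⟨ +-cong (when-false ((q ≤ᵇ N) ∧ false) (λ t → proj₂ (∧⇒ {q ≤ᵇ N} t)))
                  (∑<-cong′ n (λ k → reflexive (≡.cong (λ g → when g (cq * bellSum 1 n (N ∸ q) k)) (Boolₚ.∧-identityʳ (q ≤ᵇ N))))) ⟩
      0# + ∑< n (λ k → when (q ≤ᵇ N) (cq * bellSum 1 n (N ∸ q) k))
        ≈⟨ trans (+-identityˡ _) (sym (when-∑< (q ≤ᵇ N) n (λ k → cq * bellSum 1 n (N ∸ q) k))) ⟩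
      when (q ≤ᵇ N) (∑< n (λ k → cq * bellSum 1 n (N ∸ q) k))
        ≈⟨ when-cong (q ≤ᵇ N) (λ q≤ᵇN → value (ℕₚ.≤ᵇ⇒≤ q N q≤ᵇN)) ⟩
      when (q ≤ᵇ N) (- ((N P q) · completeSum (N ∸ q))) ∎
      where
      q = suc p
      cq = markedCoeff N q
      value : q ≤ N → ∑< n (λ k → cq * bellSum 1 n (N ∸ q) k) ≈ - ((N P q) · completeSum (N ∸ q))
      value q≤N = begin
        ∑< n (λ k → cq * bellSum 1 n (N ∸ q) k)  ≈⟨ *-distribˡ-∑< n cq (bellSum 1 n (N ∸ q)) ⟨
        cq * ∑< n (bellSum 1 n (N ∸ q))          ≈⟨ *-cong (markedCoeff-logCoeff N q (s≤s z≤n) q≤N) (completeSum-below N q (s≤s z≤n) q≤N N≤n) ⟩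
        - ((N P q) · 1#) * completeSum (N ∸ q)   ≈⟨ -‿distribˡ-* _ _ ⟨
        - ((N P q) · 1# * completeSum (N ∸ q))   ≈⟨ -‿cong (trans (×-assoc-* (N P q) 1# _) (×-congʳ (N P q) (*-identityˡ _))) ⟩
        - ((N P q) · completeSum (N ∸ q))        ∎

    completeSum-recurrence : ∀ N → N ≤ n → N · completeSum N ≈ - ∑< N (λ p → (N P suc p) · completeSum (N ∸ suc p))
    completeSum-recurrence N N≤n = begin
      N · completeSum N
        ≈⟨ ·-distrib-∑< (suc n) N (bellSum 1 n N) ⟩
      ∑< (suc n) (λ k → N · bellSum 1 n N k)
        ≈⟨ ∑<-cong′ (suc n) (λ k → euler n 0 N k N≤n) ⟩
      ∑< (suc n) (λ k → ∑< n (λ p → markedPart n 1 N k (suc p)))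
        ≈⟨ ∑<-comm (suc n) n (λ k p → markedPart n 1 N k (suc p)) ⟩
      ∑< n (λ p → ∑< (suc n) (λ k → markedPart n 1 N k (suc p)))
        ≈⟨ ∑<-cong′ n (λ p → ∑-markedPart N p N≤n) ⟩
      ∑< n (λ p → when (suc p ≤ᵇ N) (- ((N P suc p) · completeSum (N ∸ suc p))))
        ≈⟨ ∑<-truncate N n _ N≤n ⟩
      ∑< N (λ p → - ((N P suc p) · completeSum (N ∸ suc p)))
        ≈⟨ ∑<-neg N _ ⟩
      - ∑< N (λ p → (N P suc p) · completeSum (N ∸ suc p)) ∎

    bellComplete-logCoeff : 2 ≤ n → bellComplete R n logCoeff ≈ 0#
    bellComplete-logCoeff 2≤n@(s≤s _) = begin
      bellComplete R n logCoeff                          ≡⟨ sumFT≡∑< 1 n (λ k → bellPartial R n k logCoeff) ⟩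
      ∑< n (λ k → bellPartial R n (suc k) logCoeff)      ≈⟨ ∑<-cong n bellPartial≈bellSum ⟩
      ∑< n (λ k → bellSum 1 n n (suc k))                 ≈⟨ +-identityˡ _ ⟨
      0# + ∑< n (λ k → bellSum 1 n n (suc k))            ≈⟨ +-congʳ (bellSum-no-parts 0 n n) ⟨
      completeSum n                                      ≈⟨ recurrence-vanishes completeSum n completeSum-zero completeSum-recurrence n 2≤n ℕₚ.≤-refl ⟩
      0#                                                 ∎

ℤ-ring : CommutativeRing _ _
ℤ-ring = ℤₚ.+-*-commutativeRing

module ℤ-Properties where
  open ℤ using (+_)
  open RingSums ℤ-ring

  ·≡* : ∀ n z → n · z ≡ + n ℤ.* z
  ·≡* zero    z = ≡.sym (ℤₚ.*-zeroˡ z)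
  ·≡* (suc n) z = ≡.trans (≡.cong₂ ℤ._+_ (≡.sym (ℤₚ.*-identityˡ z)) (·≡* n z)) (≡.sym (ℤₚ.*-distribʳ-+ z (+ 1) (+ n)))

  ℤ-torsionFree : TorsionFree
  ℤ-torsionFree n z [1+n]z≡0 =
    ℤₚ.*-cancelˡ-≡ (+ suc n) z (+ 0) (≡.trans (≡.sym (·≡* (suc n) z)) (≡.trans [1+n]z≡0 (≡.sym (ℤₚ.*-zeroʳ (+ suc n)))))

module IntegerImage {c ℓ : Level} (R : CommutativeRing c ℓ) where
  open ℤ using (ℤ; +_; -[1+_]; _⊖_; sign; ∣_∣; _◃_)
  open CommutativeRing R
  open RingSums R
  private module ℤˢ = RingSums ℤ-ring
  open import Relation.Binary.Reasoning.Setoid setoid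
  open import Algebra.Properties.Ring ring using (-‿distribˡ-*; -‿distribʳ-*; -‿involutive; -0#≈0#; -‿+-comm)
  open import Algebra.Properties.CommutativeSemigroup +-commutativeSemigroup using (x∙yz≈y∙xz)

  private
    ι : ℕ → Carrier
    ι k = k · 1#

    intR≡ι : ∀ n → intR R (+ n) ≡ ι n
    intR≡ι n = natMul≡· n 1#

    signed : Sign.Sign → Carrier → Carrier
    signed Sign.+ x = x
    signed Sign.- x = - x

    intR-signed : ∀ z → intR R z ≈ signed (sign z) (ι ∣ z ∣)
    intR-signed (+ n)    = reflexive (intR≡ι n)
    intR-signed -[1+ n ] = -‿cong (reflexive (natMul≡· (suc n) 1#))

    intR-◃ : ∀ s k → intR R (s ◃ k) ≈ signed s (ι k)
    intR-◃ Sign.- zero    = sym -0#≈0#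
    intR-◃ Sign.+ zero    = refl
    intR-◃ Sign.- (suc k) = -‿cong (reflexive (natMul≡· (suc k) 1#))
    intR-◃ Sign.+ (suc k) = reflexive (intR≡ι (suc k))

    signed-cong : ∀ s {x y} → x ≈ y → signed s x ≈ signed s y
    signed-cong Sign.+ x≈y = x≈y
    signed-cong Sign.- x≈y = -‿cong x≈y

    signed-* : ∀ s t x y → signed (s Sign.* t) (x * y) ≈ signed s x * signed t y
    signed-* Sign.- Sign.- x y =
      sym (trans (sym (-‿distribˡ-* x (- y))) (trans (-‿cong (sym (-‿distribʳ-* x y))) (-‿involutive _)))
    signed-* Sign.- Sign.+ x y = -‿distribˡ-* x y
    signed-* Sign.+ Sign.- x y = -‿distribʳ-* x y
    signed-* Sign.+ Sign.+ x y = refl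

    intR-⊖ : ∀ m n → intR R (m ⊖ n) ≈ ι m + - ι n
    intR-⊖ m       zero    = sym (trans (+-congˡ -0#≈0#) (trans (+-identityʳ _) (sym (reflexive (intR≡ι m)))))
    intR-⊖ zero    (suc n) = sym (trans (+-identityˡ _) (-‿cong (sym (reflexive (natMul≡· (suc n) 1#)))))
    intR-⊖ (suc m) (suc n) = begin
      intR R (suc m ⊖ suc n)     ≡⟨ ≡.cong (intR R) (ℤₚ.[1+m]⊖[1+n]≡m⊖n m n) ⟩
      intR R (m ⊖ n)             ≈⟨ intR-⊖ m n ⟩
      ι m + - ι n                ≈⟨ +-congˡ (trans (+-congˡ (-‿inverseʳ 1#)) (+-identityʳ _)) ⟨
      ι m + (- ι n + (1# + - 1#)) ≈⟨ +-congˡ (x∙yz≈y∙xz (- ι n) 1# (- 1#)) ⟩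
      ι m + (1# + (- ι n + - 1#)) ≈⟨ +-assoc _ _ _ ⟨
      (ι m + 1#) + (- ι n + - 1#) ≈⟨ +-cong (+-comm _ _) (trans (+-comm _ _) (-‿+-comm 1# (ι n))) ⟩
      (1# + ι m) + - (1# + ι n)  ∎

    ι-* : ∀ a b → ι (a ℕ.* b) ≈ ι a * ι b
    ι-* a b = sym (trans (·-* a b 1# 1#) (×-congʳ (a ℕ.* b) (*-identityˡ 1#)))

  intR-+ : ∀ a b → intR R (a ℤ.+ b) ≈ intR R a + intR R b
  intR-+ -[1+ m ] -[1+ n ] = begin
    - natMul R (suc (suc (m ℕ.+ n))) 1# ≡⟨ ≡.cong (λ k → - natMul R k 1#) (≡.cong suc (ℕₚ.+-suc m n)) ⟨
    - natMul R (suc m ℕ.+ suc n) 1#     ≡⟨ ≡.cong -_ (natMul≡· (suc m ℕ.+ suc n) 1#) ⟩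
    - ι (suc m ℕ.+ suc n)               ≈⟨ -‿cong (×-homo-+ 1# (suc m) (suc n)) ⟩
    - (ι (suc m) + ι (suc n))           ≈⟨ -‿+-comm _ _ ⟨
    - ι (suc m) + - ι (suc n)           ≡⟨ ≡.cong₂ (λ u v → - u + - v) (natMul≡· (suc m) 1#) (natMul≡· (suc n) 1#) ⟨
    intR R -[1+ m ] + intR R -[1+ n ]   ∎
  intR-+ -[1+ m ] (+ n) = trans (intR-⊖ n (suc m)) (trans (+-comm _ _) (+-cong (-‿cong (sym (reflexive (natMul≡· (suc m) 1#))))
                                                                                (sym (reflexive (intR≡ι n)))))
  intR-+ (+ m) -[1+ n ] =
    trans (intR-⊖ m (suc n)) (+-cong (sym (reflexive (intR≡ι m))) (-‿cong (sym (reflexive (natMul≡· (suc n) 1#)))))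
  intR-+ (+ m) (+ n) =
    trans (reflexive (intR≡ι (m ℕ.+ n))) (trans (×-homo-+ 1# m n) (sym (+-cong (reflexive (intR≡ι m)) (reflexive (intR≡ι n)))))

  intR-neg : ∀ a → intR R (ℤ.- a) ≈ - intR R a
  intR-neg -[1+ n ]    = sym (-‿involutive _)
  intR-neg (+ zero)    = sym -0#≈0#
  intR-neg (+ suc n)   = refl

  intR-* : ∀ a b → intR R (a ℤ.* b) ≈ intR R a * intR R b
  intR-* a b = begin
    intR R (a ℤ.* b)                                     ≈⟨ intR-◃ (sign a Sign.* sign b) (∣ a ∣ ℕ.* ∣ b ∣) ⟩
    signed (sign a Sign.* sign b) (ι (∣ a ∣ ℕ.* ∣ b ∣))   ≈⟨ signed-cong (sign a Sign.* sign b) (ι-* ∣ a ∣ ∣ b ∣) ⟩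
    signed (sign a Sign.* sign b) (ι ∣ a ∣ * ι ∣ b ∣)     ≈⟨ signed-* (sign a) (sign b) _ _ ⟩
    signed (sign a) (ι ∣ a ∣) * signed (sign b) (ι ∣ b ∣) ≈⟨ *-cong (intR-signed a) (intR-signed b) ⟨
    intR R a * intR R b                                  ∎

  intR-1 : intR R (+ 1) ≈ 1#
  intR-1 = +-identityʳ 1#

  intR-· : ∀ k z → intR R (k ℤˢ.· z) ≈ k · intR R z
  intR-· zero    z = refl
  intR-· (suc k) z = trans (intR-+ z (k ℤˢ.· z)) (+-congˡ (intR-· k z))

  intR-natMul : ∀ k z → intR R (natMul ℤ-ring k z) ≈ natMul R k (intR R z)
  intR-natMul k z = trans (reflexive (≡.cong (intR R) (ℤˢ.natMul≡· k z))) (trans (intR-· k z) (reflexive (≡.sym (natMul≡· k _))))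

  intR-pow : ∀ z j → intR R (pow ℤ-ring z j) ≈ pow R (intR R z) j
  intR-pow z zero    = intR-1
  intR-pow z (suc j) = trans (intR-* z (pow ℤ-ring z j)) (*-congˡ (intR-pow z j))

  intR-monom : ∀ (y : ℕ → ℤ) i js → intR R (monom ℤ-ring y i js) ≈ monom R (λ t → intR R (y t)) i js
  intR-monom y i []       = intR-1
  intR-monom y i (j ∷ js) = trans (intR-* (pow ℤ-ring (y i) j) _) (*-cong (intR-pow (y i) j) (intR-monom y (suc i) js))

  intR-∑ᴸ : {A : Set} (as : List A) (f : A → ℤ) → intR R (ℤˢ.∑ᴸ as f) ≈ ∑ᴸ as (λ a → intR R (f a))
  intR-∑ᴸ []       f = refl
  intR-∑ᴸ (a ∷ as) f = trans (intR-+ (f a) _) (+-congˡ (intR-∑ᴸ as f))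

  intR-∑< : ∀ n (f : ℕ → ℤ) → intR R (ℤˢ.∑< n f) ≈ ∑< n (λ i → intR R (f i))
  intR-∑< zero    f = refl
  intR-∑< (suc n) f = trans (intR-+ (f 0) _) (+-congˡ (intR-∑< n (λ i → f (suc i))))

  intR-bellPartial : ∀ n k (y : ℕ → ℤ) → intR R (bellPartial ℤ-ring n k y) ≈ bellPartial R n k (λ t → intR R (y t))
  intR-bellPartial n k y = begin
    intR R (bellPartial ℤ-ring n k y)
      ≡⟨ ≡.cong (intR R) (ℤˢ.foldr-map≡∑ᴸ (bellIndices n k) _) ⟩
    intR R (ℤˢ.∑ᴸ (bellIndices n k) (λ js → natMul ℤ-ring (bellCoeff n js) (monom ℤ-ring y 1 js)))
      ≈⟨ intR-∑ᴸ (bellIndices n k) _ ⟩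
    ∑ᴸ (bellIndices n k) (λ js → intR R (natMul ℤ-ring (bellCoeff n js) (monom ℤ-ring y 1 js)))
      ≈⟨ ∑ᴸ-cong (bellIndices n k) (λ js → trans (intR-natMul (bellCoeff n js) _)
                                                (natMul-cong (bellCoeff n js) (intR-monom y 1 js))) ⟩
    ∑ᴸ (bellIndices n k) (λ js → natMul R (bellCoeff n js) (monom R (λ t → intR R (y t)) 1 js))
      ≡⟨ foldr-map≡∑ᴸ (bellIndices n k) _ ⟨
    bellPartial R n k (λ t → intR R (y t)) ∎
    where
    natMul-cong : ∀ k {x x′} → x ≈ x′ → natMul R k x ≈ natMul R k x′
    natMul-cong k x≈x′ = trans (reflexive (natMul≡· k _)) (trans (×-congʳ k x≈x′) (reflexive (≡.sym (natMul≡· k _))))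

  intR-bellComplete : ∀ n (y : ℕ → ℤ) → intR R (bellComplete ℤ-ring n y) ≈ bellComplete R n (λ t → intR R (y t))
  intR-bellComplete n y = begin
    intR R (bellComplete ℤ-ring n y)                  ≡⟨ ≡.cong (intR R) (ℤˢ.sumFT≡∑< 1 n (λ k → bellPartial ℤ-ring n k y)) ⟩
    intR R (ℤˢ.∑< n (λ k → bellPartial ℤ-ring n (suc k) y)) ≈⟨ intR-∑< n _ ⟩
    ∑< n (λ k → intR R (bellPartial ℤ-ring n (suc k) y)) ≈⟨ ∑<-cong′ n (λ k → intR-bellPartial n (suc k) y) ⟩
    ∑< n (λ k → bellPartial R n (suc k) (λ t → intR R (y t))) ≡⟨ sumFT≡∑< 1 n (λ k → bellPartial R n k (λ t → intR R (y t))) ⟨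
    bellComplete R n (λ t → intR R (y t))             ∎

open ℤ-Properties

module SigmaAtOnes {c ℓ : Level} (R : CommutativeRing c ℓ) where
  open CommutativeRing R
  open RingSums R
  open BellCongruence R
  open IntegerImage R
  private module ℤˢ = RingSums ℤ-ring
  open import Relation.Binary.Reasoning.Setoid setoid
  open import Algebra.Properties.Ring ring using (-‿distribˡ-*; -‿distribʳ-*; -‿involutive)

  ones : ℕ → Carrier
  ones _ = 1#

  σ⋆-ones-1 : σ⋆ R ones 1 ≈ 1#
  σ⋆-ones-1 = begin
    (- 1# * 1#) * (bellPartial R 1 1 (λ i → - natMul R ((i ∸ 1) !) 1#) + 0#)
      ≈⟨ *-cong (*-identityʳ _) (trans (+-identityʳ _) B₁₁) ⟩
    (- 1#) * (- (1# + 0#)) ≈⟨ -‿distribˡ-* _ _ ⟨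
    - (1# * - (1# + 0#))   ≈⟨ -‿cong (-‿distribʳ-* _ _) ⟨
    - - (1# * (1# + 0#))   ≈⟨ -‿involutive _ ⟩
    1# * (1# + 0#)         ≈⟨ trans (*-identityˡ _) (+-identityʳ 1#) ⟩
    1#                     ∎
    where
    B₁₁ : bellPartial R 1 1 (λ i → - natMul R ((i ∸ 1) !) 1#) ≈ - (1# + 0#)
    B₁₁ = trans (+-identityʳ _) (trans (+-identityʳ _) (trans (*-identityʳ _) (*-identityʳ _)))

  σ⋆-ones-2+ : ∀ t → σ⋆ R ones (2 ℕ.+ t) ≈ 0#
  σ⋆-ones-2+ t = begin
    pow R (- 1#) n * bellComplete R n (λ i → - natMul R ((i ∸ 1) !) 1#)
      ≈⟨ *-congˡ (bellComplete-cong n image) ⟩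
    pow R (- 1#) n * bellComplete R n (λ i → intR R (ℤLog.logCoeff i))
      ≈⟨ *-congˡ (intR-bellComplete n ℤLog.logCoeff) ⟨
    pow R (- 1#) n * intR R (bellComplete ℤ-ring n ℤLog.logCoeff)
      ≡⟨ ≡.cong (λ z → pow R (- 1#) n * intR R z) (ℤLog.bellComplete-logCoeff n (s≤s (s≤s z≤n))) ⟩
    pow R (- 1#) n * 0#
      ≈⟨ zeroʳ _ ⟩
    0# ∎
    where
    n = 2 ℕ.+ t
    module ℤLog = LogarithmicBell ℤ-ring ℤ-torsionFree
    image : ∀ i → - natMul R ((i ∸ 1) !) 1# ≈ intR R (ℤLog.logCoeff i)
    image i = sym (begin
      intR R (ℤ.- (((i ∸ 1) !) ℤˢ.· ℤ.1ℤ))     ≈⟨ intR-neg (((i ∸ 1) !) ℤˢ.· ℤ.1ℤ) ⟩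
      - intR R (((i ∸ 1) !) ℤˢ.· ℤ.1ℤ)         ≈⟨ -‿cong (intR-· ((i ∸ 1) !) ℤ.1ℤ) ⟩
      - (((i ∸ 1) !) · intR R ℤ.1ℤ)            ≈⟨ -‿cong (×-congʳ ((i ∸ 1) !) intR-1) ⟩
      - (((i ∸ 1) !) · 1#)                     ≡⟨ ≡.cong -_ (natMul≡· ((i ∸ 1) !) 1#) ⟨
      - natMul R ((i ∸ 1) !) 1#                ∎)

  ψ-ones : ∀ m → ψ R ones (suc m) ≈ natMul R (suc m !) 1# + sumFT R 2 (suc m) (λ j → natMul R (ff (suc m) (suc m ∸ j)) (Ψ R ones j))
  ψ-ones m = begin
    ψ R ones n
      ≈⟨ PsiUnrolling.ψ≈∑ R ones n ⟩
    ff n (n ∸ 1) · (σ⋆ R ones 1 + 0#) + ∑< m (λ i → ff n (n ∸ (2 ℕ.+ i)) · (σ⋆ R ones (2 ℕ.+ i) + Ψ R ones (2 ℕ.+ i)))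
      ≈⟨ +-cong (×-cong ff[n,n-1]≡n! (trans (+-identityʳ _) σ⋆-ones-1))
                (∑<-cong′ m (λ i → ×-congʳ (ff n (n ∸ (2 ℕ.+ i))) (trans (+-congʳ (σ⋆-ones-2+ i)) (+-identityˡ _)))) ⟩
    (n !) · 1# + ∑< m (λ i → ff n (n ∸ (2 ℕ.+ i)) · Ψ R ones (2 ℕ.+ i))
      ≈⟨ +-cong (reflexive (≡.sym (natMul≡· (n !) 1#)))
                (∑<-cong′ m (λ i → reflexive (≡.sym (natMul≡· (ff n (n ∸ (2 ℕ.+ i))) (Ψ R ones (2 ℕ.+ i)))))) ⟩
    natMul R (n !) 1# + ∑< m (λ i → natMul R (ff n (n ∸ (2 ℕ.+ i))) (Ψ R ones (2 ℕ.+ i)))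
      ≡⟨ ≡.cong (natMul R (n !) 1# +_) (sumFT≡∑< 2 n (λ j → natMul R (ff n (n ∸ j)) (Ψ R ones j))) ⟨
    natMul R (n !) 1# + sumFT R 2 n (λ j → natMul R (ff n (n ∸ j)) (Ψ R ones j)) ∎
    where
    n = suc m
    ff[n,n-1]≡n! : ff n (n ∸ 1) ≡ n !
    ff[n,n-1]≡n! = ≡.trans (≡.sym (ℕₚ.*-identityʳ _)) (ff[n,n∸j]*j!≡n! n 1 (s≤s z≤n))

corollary4p2 : {c ℓ : Level} (R : CommutativeRing c ℓ) (x : ℕ → CommutativeRing.Carrier R) (n : ℕ) → 1 ≤ n →
    CommutativeRing._≈_ R (ψ R x n)
      (sumFT R 1 n (λ j → natMul R (ff n (n ∸ j)) (CommutativeRing._+_ R (σ⋆ R x j) (Ψ R x j))))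
    × CommutativeRing._≈_ R (ψ R (λ _ → CommutativeRing.1# R) n)
      (CommutativeRing._+_ R (natMul R (n !) (CommutativeRing.1# R))
        (sumFT R 2 n (λ j → natMul R (ff n (n ∸ j)) (Ψ R (λ _ → CommutativeRing.1# R) j))))
corollary4p2 R x (suc m) _ = PsiUnrolling.ψ≈sumFT R x (suc m) , SigmaAtOnes.ψ-ones R m
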